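{- The following formulas are derivable in $FO\lambda^{\Delta\mathbb{N}}$ using the definition $\mathcal{D}(nat)\cup\mathcal{D}_{list}(atm)\cup\mathcal{D}(intuit)$: Specialization: $\forall i\forall b\forall l(nat\,i\supset seq_{(s\,i)}\,l\,(\bigwedge b)\supset\forall x\,seq_i\,l\,(b\,x))$; Cut: $\forall a\forall b\forall l(\vdash_{(a::l)} b\supset\ \vdash_l\langle a\rangle\supset\ \vdash_l b)$; Structural rules: $\forall i\forall b\forall l\forall l'(nat\,i\supset\forall a(element\,a\,l\supset element\,a\,l')\supset seq_i\,l\,b\supset seq_i\,l'\,b)$.
   Context: $FO\lambda^{\Delta\mathbb{N}}$ is the following intuitionistic sequent calculus. Terms are simply typed $\lambda$-terms (up to $\alpha\beta\eta$-conversion) over a signature of typed constants; $o$ is the type of formulas, and quantifiers range only over types not containing $o$. Formulas are built from atomic formulas with $\bot,\top,\land,\lor,\supset$ (right-associative), $\forall,\exists$. There is a type $nt$ with constants $z:nt$, $s:nt\to nt$ and a predicate $nat: nt\to o$. Sequents are $\Gamma\longrightarrow B$, $\Gamma$ a finite multiset. Rules: $\bot,\Gamma\longrightarrow B$ and $\Gamma\longrightarrow\top$ are axioms; the usual intuitionistic left and right rules for $\land,\lor,\supset,\forall,\exists$ (with the usual eigenvariable conditions); initial sequents $A,\Gamma\longrightarrow A$ for atomic $A$; left contraction; cut. For $nat$: $\Gamma\longrightarrow nat\,z$; from $\Gamma\longrightarrow nat\,I$ infer $\Gamma\longrightarrow nat\,(s\,I)$; induction: for $B:nt\to o$ and eigenvariable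 $j$ not free in $B$, from $\longrightarrow B\,z$, $B\,j\longrightarrow B\,(s\,j)$, $B\,I,\Gamma\longrightarrow C$ infer $nat\,I,\Gamma\longrightarrow C$. Relative to a definition (set of clauses $\forall\bar x[p\,\bar t\triangleq B]$, free variables of $B$ occurring in $\bar t$, satisfying a level condition): right rule: from $\Gamma\longrightarrow B\theta$ infer $\Gamma\longrightarrow p\,\bar u$ when $p\,\bar u=(p\,\bar t)\theta$; left rule: infer $p\,\bar u,\Gamma\longrightarrow C$ from the premises $B\theta,\Gamma\theta\longrightarrow C\theta$ for every clause (renamed apart) and every $\theta$ in a complete set of unifiers of $p\,\bar u$ and $p\,\bar t$ (a predicate with no clauses thus admits the left rule with zero premises). A formula is derivable using a definition if $\longrightarrow F$ has a derivation. $\mathcal{D}(nat)$: predicates $=,<,\le: nt\to nt\to o$, $sum: nt\to nt\to nt\to o$; clauses $I=I\triangleq\top$; $sum\,z\,J\,J\triangleq nat\,J$; $sum\,(s\,I)\,J\,(s\,K)\triangleq sum\,I\,J\,K$; $z<(s\,J)\triangleq nat\,J$; $(s\,I)<(s\,J)\triangleq I<J$; $I\le I\triangleq\top$; $I\le J\triangleq I<J$. Object logic: types $i$, $atm$, $prp$, constants $\langle\cdot\rangle: atm\to prp$, $tt: prp$, $\&: prp\to prp\to prp$, $\Rightarrow: atm\to prp\to prp$, $\bigwedge: (i\to prp)\to prp$. $atmlst$ is the list type over $atm$ with $nil$ and infix $::$. $\mathcal{D}_{list}(atm)$ has clauses $length\,nil\,z\triangleq\top$; $length\,(X::L)\,(s\,I)\triangleq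 length\,L\,I$; $list\,L\triangleq\exists i(nat\,i\land length\,L\,i)$; $element\,X\,(X::L)\triangleq\top$; $element\,X\,(Y::L)\triangleq element\,X\,L$; $split\,nil\,nil\,nil\triangleq\top$; $split\,(X::L_1)\,(X::L_2)\,L_3\triangleq split\,L_1\,L_2\,L_3$; $split\,(X::L_1)\,L_2\,(X::L_3)\triangleq split\,L_1\,L_2\,L_3$; $permute\,nil\,nil\triangleq\top$; $permute\,(X::L_1)\,L_2\triangleq\exists l_{22}(split\,L_2\,(X::nil)\,l_{22}\land permute\,L_1\,l_{22})$. With $prog: atm\to prp\to o$ and $seq: nt\to atmlst\to prp\to o$ (first argument as subscript), $\mathcal{D}(intuit)$ is: $seq_I\,(A'::L)\,\langle A\rangle\triangleq element\,A\,(A'::L)$; $seq_I\,L\,tt\triangleq\top$; $seq_{(s I)}\,L\,(B\,\&\,C)\triangleq seq_I\,L\,B\land seq_I\,L\,C$; $seq_{(s I)}\,L\,(A\Rightarrow B)\triangleq seq_I\,(A::L)\,B$; $seq_{(s I)}\,L\,(\bigwedge B)\triangleq\forall x\,seq_I\,L\,(B\,x)$; $seq_{(s I)}\,L\,\langle A\rangle\triangleq\exists b(prog\,A\,b\land seq_I\,L\,b)$. $\vdash_L B$ abbreviates $\exists i(nat\,i\land seq_i\,L\,B)$. -}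

module Defs where

open import Data.List using (List; []; _∷_; _++_; map)
open import Data.List.Membership.Propositional using (_∈_)
open import Data.List.Relation.Binary.Permutation.Propositional using (_↭_)
open import Data.List.Relation.Binary.Pointwise using (Pointwise)
open import Data.Product using (Σ; ∃; ∃-syntax; _×_; _,_)
open import Data.Unit using (⊤; tt)
open import Data.Empty using (⊥)
open import Relation.Nullary using (¬_)

data Base : Set where
  i atm prp nt atmlst o : Base

infixr 7 _⇒_
data Ty : Set where
  ι   : Base → Ty
  _⇒_ : Ty → Ty → Ty

Ti Tatm Tprp Tnt Tlst To : Ty
Ti = ι i
Tatm = ι atm
Tprp = ι prp
Tnt = ι nt
Tlst = ι atmlst
To = ι o

-- types not containing o (the only types quantifiers may range over)
NoO : Ty → Set
NoO (ι o) = ⊥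
NoO (ι _) = ⊤
NoO (a ⇒ b) = NoO a × NoO b

data Const : Ty → Set where
  objc   : Const (Tatm ⇒ Tprp)
  ttc    : Const Tprp
  ampc   : Const (Tprp ⇒ Tprp ⇒ Tprp)
  oimpc  : Const (Tatm ⇒ Tprp ⇒ Tprp)
  oallc  : Const ((Ti ⇒ Tprp) ⇒ Tprp)
  zc     : Const Tnt
  sc     : Const (Tnt ⇒ Tnt)
  natc   : Const (Tnt ⇒ To)
  nilc   : Const Tlst
  consc  : Const (Tatm ⇒ Tlst ⇒ Tlst)
  eqc ltc lec : Const (Tnt ⇒ Tnt ⇒ To)
  sumc   : Const (Tnt ⇒ Tnt ⇒ Tnt ⇒ To)
  lengthc : Const (Tlst ⇒ Tnt ⇒ To)
  listc  : Const (Tlst ⇒ To)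
  elementc : Const (Tatm ⇒ Tlst ⇒ To)
  splitc : Const (Tlst ⇒ Tlst ⇒ Tlst ⇒ To)
  permutec : Const (Tlst ⇒ Tlst ⇒ To)
  progc  : Const (Tatm ⇒ Tprp ⇒ To)
  seqc   : Const (Tnt ⇒ Tlst ⇒ Tprp ⇒ To)
  botc topc : Const To
  andc orc impc : Const (To ⇒ To ⇒ To)
  allc exc : (τ : Ty) → NoO τ → Const ((τ ⇒ To) ⇒ To)

data IsLogical : ∀ {τ} → Const τ → Set where
  lbot : IsLogical botc
  ltop : IsLogical topc
  land : IsLogical andc
  lor  : IsLogical orc
  limp : IsLogical impc
  lall : ∀ τ p → IsLogical (allc τ p)
  lex  : ∀ τ p → IsLogical (exc τ p)

data IsNat : ∀ {τ} → Const τ → Set where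
  isNat : IsNat natc

Ctx : Set
Ctx = List Ty

infix 4 _∋_
data _∋_ : Ctx → Ty → Set where
  here  : ∀ {Γ τ} → (τ ∷ Γ) ∋ τ
  there : ∀ {Γ τ σ} → Γ ∋ τ → (σ ∷ Γ) ∋ τ

data Tm (Γ : Ctx) : Ty → Set where
  var : ∀ {τ} → Γ ∋ τ → Tm Γ τ
  con : ∀ {τ} → Const τ → Tm Γ τ
  app : ∀ {τ σ} → Tm Γ (τ ⇒ σ) → Tm Γ τ → Tm Γ σ
  lam : ∀ {τ σ} → Tm (τ ∷ Γ) σ → Tm Γ (τ ⇒ σ)

Ren : Ctx → Ctx → Set
Ren Γ Δ = ∀ {τ} → Γ ∋ τ → Δ ∋ τ

ext : ∀ {Γ Δ σ} → Ren Γ Δ → Ren (σ ∷ Γ) (σ ∷ Δ)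
ext ρ here = here
ext ρ (there x) = there (ρ x)

rename : ∀ {Γ Δ τ} → Ren Γ Δ → Tm Γ τ → Tm Δ τ
rename ρ (var x) = var (ρ x)
rename ρ (con c) = con c
rename ρ (app t u) = app (rename ρ t) (rename ρ u)
rename ρ (lam t) = lam (rename (ext ρ) t)

wk : ∀ {Γ σ τ} → Tm Γ τ → Tm (σ ∷ Γ) τ
wk = rename there

Sub : Ctx → Ctx → Set
Sub Γ Δ = ∀ {τ} → Γ ∋ τ → Tm Δ τ

exts : ∀ {Γ Δ σ} → Sub Γ Δ → Sub (σ ∷ Γ) (σ ∷ Δ)
exts θ here = var here
exts θ (there x) = wk (θ x)

subst : ∀ {Γ Δ τ} → Sub Γ Δ → Tm Γ τ → Tm Δ τ
subst θ (var x) = θ x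
subst θ (con c) = con c
subst θ (app t u) = app (subst θ t) (subst θ u)
subst θ (lam t) = lam (subst (exts θ) t)

single : ∀ {Γ σ} → Tm Γ σ → Sub (σ ∷ Γ) Γ
single u here = u
single u (there x) = var x

_[_] : ∀ {Γ σ τ} → Tm (σ ∷ Γ) τ → Tm Γ σ → Tm Γ τ
t [ u ] = subst (single u) t

-- αβη-conversion (α is built into de Bruijn syntax)
infix 4 _≈_
data _≈_ : ∀ {Γ τ} → Tm Γ τ → Tm Γ τ → Set where
  ≈refl  : ∀ {Γ τ} {t : Tm Γ τ} → t ≈ t
  ≈sym   : ∀ {Γ τ} {t u : Tm Γ τ} → t ≈ u → u ≈ t
  ≈trans : ∀ {Γ τ} {t u v : Tm Γ τ} → t ≈ u → u ≈ v → t ≈ v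
  app≈   : ∀ {Γ τ σ} {t t' : Tm Γ (τ ⇒ σ)} {u u' : Tm Γ τ} →
           t ≈ t' → u ≈ u' → app t u ≈ app t' u'
  lam≈   : ∀ {Γ τ σ} {t t' : Tm (τ ∷ Γ) σ} → t ≈ t' → lam t ≈ lam t'
  β≈     : ∀ {Γ τ σ} (t : Tm (τ ∷ Γ) σ) (u : Tm Γ τ) → app (lam t) u ≈ t [ u ]
  η≈     : ∀ {Γ τ σ} (t : Tm Γ (τ ⇒ σ)) → lam (app (wk t) (var here)) ≈ t

Form : Ctx → Set
Form Γ = Tm Γ To

infixl 9 _·_
_·_ : ∀ {Γ τ σ} → Tm Γ (τ ⇒ σ) → Tm Γ τ → Tm Γ σ
_·_ = app

module Notation {Γ : Ctx} where
  fbot ftop : Form Γ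
  fbot = con botc
  ftop = con topc
  fand for fimp : Form Γ → Form Γ → Form Γ
  fand A B = con andc · A · B
  for A B = con orc · A · B
  fimp A B = con impc · A · B
  fall fex : (τ : Ty) → NoO τ → Tm Γ (τ ⇒ To) → Form Γ
  fall τ p B = con (allc τ p) · B
  fex τ p B = con (exc τ p) · B
open Notation public

data Spine {Γ : Ctx} (P : ∀ {τ} → Const τ → Set) : ∀ {τ} → Tm Γ τ → Set where
  hd  : ∀ {τ} (c : Const τ) → P c → Spine P (con c)
  arg : ∀ {τ σ} {t : Tm Γ (τ ⇒ σ)} {u : Tm Γ τ} → Spine P t → Spine P (app t u)

Atomic : ∀ {Γ} → Form Γ → Set
Atomic = Spine (λ c → ¬ IsLogical c)

-- atoms to which the definitional left rule applies (nat has its own rules)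
DefAtom : ∀ {Γ} → Form Γ → Set
DefAtom = Spine (λ c → ¬ IsLogical c × ¬ IsNat c)

-- Definitions: clauses ∀x̄ [p t̄ ≜ B]

record Clause : Set where
  constructor clause
  field
    vars : Ctx
    head : Form vars
    body : Form vars
open Clause public

v0 : ∀ {Γ a} → Tm (a ∷ Γ) a
v0 = var here
v1 : ∀ {Γ a b} → Tm (b ∷ a ∷ Γ) a
v1 = var (there here)
v2 : ∀ {Γ a b c} → Tm (c ∷ b ∷ a ∷ Γ) a
v2 = var (there (there here))
v3 : ∀ {Γ a b c d} → Tm (d ∷ c ∷ b ∷ a ∷ Γ) a
v3 = var (there (there (there here)))

module Sig {Γ : Ctx} where
  z' : Tm Γ Tnt
  z' = con zc
  s' : Tm Γ Tnt → Tm Γ Tnt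
  s' n = con sc · n
  nat' : Tm Γ Tnt → Form Γ
  nat' n = con natc · n
  nil' : Tm Γ Tlst
  nil' = con nilc
  infixr 5 _::_
  _::_ : Tm Γ Tatm → Tm Γ Tlst → Tm Γ Tlst
  x :: l = con consc · x · l
  ⟨_⟩ : Tm Γ Tatm → Tm Γ Tprp
  ⟨ a ⟩ = con objc · a
  tt' : Tm Γ Tprp
  tt' = con ttc
  _&_ : Tm Γ Tprp → Tm Γ Tprp → Tm Γ Tprp
  b & c = con ampc · b · c
  _⇛_ : Tm Γ Tatm → Tm Γ Tprp → Tm Γ Tprp
  a ⇛ b = con oimpc · a · b
  ⋀ : Tm Γ (Ti ⇒ Tprp) → Tm Γ Tprp
  ⋀ b = con oallc · b
  eq' lt' le' : Tm Γ Tnt → Tm Γ Tnt → Form Γ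
  eq' m n = con eqc · m · n
  lt' m n = con ltc · m · n
  le' m n = con lec · m · n
  sum' : Tm Γ Tnt → Tm Γ Tnt → Tm Γ Tnt → Form Γ
  sum' m n k = con sumc · m · n · k
  length' : Tm Γ Tlst → Tm Γ Tnt → Form Γ
  length' l n = con lengthc · l · n
  list' : Tm Γ Tlst → Form Γ
  list' l = con listc · l
  element' : Tm Γ Tatm → Tm Γ Tlst → Form Γ
  element' x l = con elementc · x · l
  split' : Tm Γ Tlst → Tm Γ Tlst → Tm Γ Tlst → Form Γ
  split' a b c = con splitc · a · b · c
  permute' : Tm Γ Tlst → Tm Γ Tlst → Form Γ
  permute' a b = con permutec · a · b
  prog' : Tm Γ Tatm → Tm Γ Tprp → Form Γ
  prog' a b = con progc · a · b
  seq' : Tm Γ Tnt → Tm Γ Tlst → Tm Γ Tprp → Form Γ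
  seq' n l b = con seqc · n · l · b
open Sig public

⊢_⟦_⟧ : ∀ {Γ} → Tm Γ Tlst → Tm Γ Tprp → Form Γ
⊢ L ⟦ B ⟧ = fex Tnt tt (lam (fand (nat' v0) (seq' v0 (wk L) (wk B))))

𝒟 : List Clause
𝒟 =
    clause (Tnt ∷ []) (eq' v0 v0) ftop
  ∷ clause (Tnt ∷ []) (sum' z' v0 v0) (nat' v0)
  ∷ clause (Tnt ∷ Tnt ∷ Tnt ∷ []) (sum' (s' v0) v1 (s' v2)) (sum' v0 v1 v2)
  ∷ clause (Tnt ∷ []) (lt' z' (s' v0)) (nat' v0)
  ∷ clause (Tnt ∷ Tnt ∷ []) (lt' (s' v0) (s' v1)) (lt' v0 v1)
  ∷ clause (Tnt ∷ []) (le' v0 v0) ftop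
  ∷ clause (Tnt ∷ Tnt ∷ []) (le' v0 v1) (lt' v0 v1)
  ∷ clause [] (length' nil' z') ftop
  ∷ clause (Tatm ∷ Tlst ∷ Tnt ∷ []) (length' (v0 :: v1) (s' v2)) (length' v1 v2)
  ∷ clause (Tlst ∷ []) (list' v0) (fex Tnt tt (lam (fand (nat' v0) (length' v1 v0))))
  ∷ clause (Tatm ∷ Tlst ∷ []) (element' v0 (v0 :: v1)) ftop
  ∷ clause (Tatm ∷ Tatm ∷ Tlst ∷ []) (element' v0 (v1 :: v2)) (element' v0 v2)
  ∷ clause [] (split' nil' nil' nil') ftop
  ∷ clause (Tatm ∷ Tlst ∷ Tlst ∷ Tlst ∷ []) (split' (v0 :: v1) (v0 :: v2) v3) (split' v1 v2 v3)
  ∷ clause (Tatm ∷ Tlst ∷ Tlst ∷ Tlst ∷ []) (split' (v0 :: v1) v2 (v0 :: v3)) (split' v1 v2 v3)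
  ∷ clause [] (permute' nil' nil') ftop
  ∷ clause (Tatm ∷ Tlst ∷ Tlst ∷ []) (permute' (v0 :: v1) v2)
      (fex Tlst tt (lam (fand (split' v3 (v1 :: nil') v0) (permute' v2 v0))))
  ∷ clause (Tnt ∷ Tatm ∷ Tlst ∷ Tatm ∷ []) (seq' v0 (v1 :: v2) ⟨ v3 ⟩) (element' v3 (v1 :: v2))
  ∷ clause (Tnt ∷ Tlst ∷ []) (seq' v0 v1 tt') ftop
  ∷ clause (Tnt ∷ Tlst ∷ Tprp ∷ Tprp ∷ []) (seq' (s' v0) v1 (v2 & v3)) (fand (seq' v0 v1 v2) (seq' v0 v1 v3))
  ∷ clause (Tnt ∷ Tlst ∷ Tatm ∷ Tprp ∷ []) (seq' (s' v0) v1 (v2 ⇛ v3)) (seq' v0 (v2 :: v1) v3)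
  ∷ clause (Tnt ∷ Tlst ∷ (Ti ⇒ Tprp) ∷ []) (seq' (s' v0) v1 (⋀ v2))
      (fall Ti tt (lam (seq' v1 v2 (v3 · v0))))
  ∷ clause (Tnt ∷ Tlst ∷ Tatm ∷ []) (seq' (s' v0) v1 ⟨ v2 ⟩)
      (fex Tprp tt (lam (fand (prog' v3 v0) (seq' v1 v2 v0))))
  ∷ []

-- Unifiers and complete sets of unifiers for p ū (over eigenvariables Σ)
-- and a clause head p t̄ (over the clause variables, renamed apart).

Unifier : ∀ {Σ' Σ''} → Form Σ' → (cl : Clause) → Sub Σ' Σ'' → Sub (vars cl) Σ'' → Set
Unifier A cl θ₁ θ₂ = subst θ₁ A ≈ subst θ₂ (head cl)

record CSU {Σ' : Ctx} (A : Form Σ') (cl : Clause) : Set₁ where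
  field
    mem      : (Δ : Ctx) → Sub Σ' Δ → Sub (vars cl) Δ → Set
    sound    : ∀ {Δ} {θ₁ : Sub Σ' Δ} {θ₂ : Sub (vars cl) Δ} → mem Δ θ₁ θ₂ → Unifier A cl θ₁ θ₂
    complete : ∀ (Δ' : Ctx) (ρ₁ : Sub Σ' Δ') (ρ₂ : Sub (vars cl) Δ') →
               Unifier A cl ρ₁ ρ₂ →
               ∃[ Δ ] Σ (Sub Σ' Δ) λ θ₁ → Σ (Sub (vars cl) Δ) λ θ₂ →
                 mem Δ θ₁ θ₂ × Σ (Sub Δ Δ') λ σ →
                   (∀ {τ} (x : Σ' ∋ τ) → ρ₁ x ≈ subst σ (θ₁ x)) ×
                   (∀ {τ} (x : vars cl ∋ τ) → ρ₂ x ≈ subst σ (θ₂ x))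
open CSU public

-- Sequents  Σ ; Γ ⟶ C  (Σ: eigenvariables, Γ: finite multiset as list)

infix 3 _⨾_⟶_
data _⨾_⟶_ : (Σ' : Ctx) → List (Form Σ') → Form Σ' → Set₁ where
  -- multiset / up-to-βη bookkeeping
  exch   : ∀ {Σ' Γ Γ' C} → Γ ↭ Γ' → Σ' ⨾ Γ ⟶ C → Σ' ⨾ Γ' ⟶ C
  conv   : ∀ {Σ' Γ Γ' C C'} → Pointwise _≈_ Γ Γ' → C ≈ C' →
           Σ' ⨾ Γ ⟶ C → Σ' ⨾ Γ' ⟶ C'
  botL   : ∀ {Σ' Γ B} → Σ' ⨾ fbot ∷ Γ ⟶ B
  topR   : ∀ {Σ' Γ} → Σ' ⨾ Γ ⟶ ftop
  init   : ∀ {Σ' Γ A} → Atomic A → Σ' ⨾ A ∷ Γ ⟶ A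
  contr  : ∀ {Σ' Γ A C} → Σ' ⨾ A ∷ A ∷ Γ ⟶ C → Σ' ⨾ A ∷ Γ ⟶ C
  cut    : ∀ {Σ' Δ Γ B C} → Σ' ⨾ Δ ⟶ B → Σ' ⨾ B ∷ Γ ⟶ C → Σ' ⨾ Δ ++ Γ ⟶ C
  andL₁  : ∀ {Σ' Γ B C D} → Σ' ⨾ B ∷ Γ ⟶ D → Σ' ⨾ fand B C ∷ Γ ⟶ D
  andL₂  : ∀ {Σ' Γ B C D} → Σ' ⨾ C ∷ Γ ⟶ D → Σ' ⨾ fand B C ∷ Γ ⟶ D
  andR   : ∀ {Σ' Γ B C} → Σ' ⨾ Γ ⟶ B → Σ' ⨾ Γ ⟶ C → Σ' ⨾ Γ ⟶ fand B C
  orL    : ∀ {Σ' Γ B C D} → Σ' ⨾ B ∷ Γ ⟶ D → Σ' ⨾ C ∷ Γ ⟶ D → Σ' ⨾ for B C ∷ Γ ⟶ D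
  orR₁   : ∀ {Σ' Γ B C} → Σ' ⨾ Γ ⟶ B → Σ' ⨾ Γ ⟶ for B C
  orR₂   : ∀ {Σ' Γ B C} → Σ' ⨾ Γ ⟶ C → Σ' ⨾ Γ ⟶ for B C
  impL   : ∀ {Σ' Γ B C D} → Σ' ⨾ Γ ⟶ B → Σ' ⨾ C ∷ Γ ⟶ D → Σ' ⨾ fimp B C ∷ Γ ⟶ D
  impR   : ∀ {Σ' Γ B C} → Σ' ⨾ B ∷ Γ ⟶ C → Σ' ⨾ Γ ⟶ fimp B C
  -- quantifier rules (eigenvariable condition via context extension)
  allL   : ∀ {Σ' Γ τ p B C} (t : Tm Σ' τ) → Σ' ⨾ B · t ∷ Γ ⟶ C → Σ' ⨾ fall τ p B ∷ Γ ⟶ C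
  allR   : ∀ {Σ' Γ τ p B} → τ ∷ Σ' ⨾ map wk Γ ⟶ wk B · v0 → Σ' ⨾ Γ ⟶ fall τ p B
  exL    : ∀ {Σ' Γ τ p B C} → τ ∷ Σ' ⨾ wk B · v0 ∷ map wk Γ ⟶ wk C → Σ' ⨾ fex τ p B ∷ Γ ⟶ C
  exR    : ∀ {Σ' Γ τ p B} (t : Tm Σ' τ) → Σ' ⨾ Γ ⟶ B · t → Σ' ⨾ Γ ⟶ fex τ p B
  natZ   : ∀ {Σ' Γ} → Σ' ⨾ Γ ⟶ nat' z'
  natS   : ∀ {Σ' Γ I} → Σ' ⨾ Γ ⟶ nat' I → Σ' ⨾ Γ ⟶ nat' (s' I)
  natInd : ∀ {Σ' Γ I C} (B : Tm Σ' (Tnt ⇒ To)) →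
           Σ' ⨾ [] ⟶ B · z' →
           Tnt ∷ Σ' ⨾ wk B · v0 ∷ [] ⟶ wk B · s' v0 →
           Σ' ⨾ B · I ∷ Γ ⟶ C →
           Σ' ⨾ nat' I ∷ Γ ⟶ C
  defR   : ∀ {Σ' Γ} (cl : Clause) → cl ∈ 𝒟 → (θ : Sub (vars cl) Σ') →
           Σ' ⨾ Γ ⟶ subst θ (body cl) → Σ' ⨾ Γ ⟶ subst θ (head cl)
  defL   : ∀ {Σ' Γ A C} → DefAtom A →
           (S : (cl : Clause) → cl ∈ 𝒟 → CSU A cl) →
           ((cl : Clause) (m : cl ∈ 𝒟) {Δ : Ctx} {θ₁ : Sub Σ' Δ} {θ₂ : Sub (vars cl) Δ} →
              mem (S cl m) Δ θ₁ θ₂ →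
              Δ ⨾ subst θ₂ (body cl) ∷ map (subst θ₁) Γ ⟶ subst θ₁ C) →
           Σ' ⨾ A ∷ Γ ⟶ C

Derivable : Form [] → Set₁
Derivable F = [] ⨾ [] ⟶ F

Specialization : Form []
Specialization =
  fall Tnt tt (lam (fall (Ti ⇒ Tprp) (tt , tt) (lam (fall Tlst tt (lam
    (fimp (nat' v2) (fimp (seq' (s' v2) v0 (⋀ v1))
      (fall Ti tt (lam (seq' v3 v1 (v2 · v0)))))))))))

CutFormula : Form []
CutFormula =
  fall Tatm tt (lam (fall Tprp tt (lam (fall Tlst tt (lam
    (fimp (⊢ v2 :: v0 ⟦ v1 ⟧) (fimp (⊢ v0 ⟦ ⟨ v2 ⟩ ⟧) (⊢ v0 ⟦ v1 ⟧))))))))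

Structural : Form []
Structural =
  fall Tnt tt (lam (fall Tprp tt (lam (fall Tlst tt (lam (fall Tlst tt (lam
    (fimp (nat' v3)
      (fimp (fall Tatm tt (lam (fimp (element' v0 v2) (element' v0 v1))))
        (fimp (seq' v3 v1 v2) (seq' v3 v0 v2)))))))))))

{-# OPTIONS --safe #-}
-- Unification in the definitional left rule is modulo βη, so inverting a defined atom
-- needs injectivity and disjointness of constants up to ≈; both follow from normalisation
-- by evaluation, since convertible terms have the same normal form.
-- Specialization is then inversion of seq_(s i) l (⋀ b): the only matching clause has the
-- conclusion as its body. Structural is proved by induction on i with the invariant
-- ∀b∀l∀l′ (l ⊆ l′ ⊃ seq_i l b ⊃ seq_i l′ b), inverting seq_i l b clause by clause; the ⇒
-- case extends the inclusion to a::l ⊆ a::l′. For Cut, prog has no clauses, so ⊢_l ⟨a⟩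
-- forces element a l; hence a::l ⊆ l, and monotonicity turns ⊢_(a::l) b into ⊢_l b.
module Submission where

open import Data.Empty using (⊥; ⊥-elim)
open import Data.Fin using (Fin; #_)
open import Data.List using (List; []; _∷_; map; lookup; length)
open import Data.List.Membership.Propositional.Properties using (∈-lookup)
open import Data.List.Relation.Binary.Permutation.Propositional as ↭ using (prep; swap)
open import Data.List.Relation.Binary.Pointwise as Pointwise using (Pointwise; _∷_)
open import Data.List.Relation.Unary.All as All using (All; []; _∷_)
open import Data.Maybe using (Maybe; just; nothing)
open import Data.Product using (_×_; _,_; proj₁; proj₂; ∃)
open import Data.Unit using (tt)
open import Relation.Binary.PropositionalEquality using (_≡_; _≢_; refl; sym; trans; cong; cong₂; module ≡-Reasoning)

open import Defs

private variable
  Γ Δ Δ′ Θ : Ctx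
  τ σ : Ty
  b : Base

≡⇒≈ : {t u : Tm Γ τ} → t ≡ u → t ≈ u
≡⇒≈ refl = ≈refl

rename-id : {ρ : Ren Γ Γ} → (∀ {τ} (x : Γ ∋ τ) → ρ x ≡ x) → (t : Tm Γ τ) → rename ρ t ≡ t
rename-id e (var x) = cong var (e x)
rename-id e (con c) = refl
rename-id e (app t u) = cong₂ app (rename-id e t) (rename-id e u)
rename-id {ρ = ρ} e (lam t) = cong lam (rename-id e′ t)
  where
  e′ : ∀ {τ} (x : _ ∋ τ) → ext ρ x ≡ x
  e′ here = refl
  e′ (there x) = cong there (e x)

rename-∘ : {ρ : Ren Γ Δ} {ρ′ : Ren Δ Θ} {ρ″ : Ren Γ Θ} → (∀ {τ} (x : Γ ∋ τ) → ρ′ (ρ x) ≡ ρ″ x) →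
           (t : Tm Γ τ) → rename ρ′ (rename ρ t) ≡ rename ρ″ t
rename-∘ e (var x) = cong var (e x)
rename-∘ e (con c) = refl
rename-∘ e (app t u) = cong₂ app (rename-∘ e t) (rename-∘ e u)
rename-∘ {ρ = ρ} {ρ′} {ρ″} e (lam t) = cong lam (rename-∘ e′ t)
  where
  e′ : ∀ {τ} (x : _ ∋ τ) → ext ρ′ (ext ρ x) ≡ ext ρ″ x
  e′ here = refl
  e′ (there x) = cong there (e x)

subst-rename : {ρ : Ren Γ Δ} {θ : Sub Δ Θ} {θ′ : Sub Γ Θ} → (∀ {τ} (x : Γ ∋ τ) → θ (ρ x) ≡ θ′ x) →
               (t : Tm Γ τ) → subst θ (rename ρ t) ≡ subst θ′ t
subst-rename e (var x) = e x
subst-rename e (con c) = refl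
subst-rename e (app t u) = cong₂ app (subst-rename e t) (subst-rename e u)
subst-rename {ρ = ρ} {θ} {θ′} e (lam t) = cong lam (subst-rename e′ t)
  where
  e′ : ∀ {τ} (x : _ ∋ τ) → exts θ (ext ρ x) ≡ exts θ′ x
  e′ here = refl
  e′ (there x) = cong wk (e x)

rename-subst : {θ : Sub Γ Δ} {ρ : Ren Δ Θ} {θ′ : Sub Γ Θ} → (∀ {τ} (x : Γ ∋ τ) → rename ρ (θ x) ≡ θ′ x) →
               (t : Tm Γ τ) → rename ρ (subst θ t) ≡ subst θ′ t
rename-subst e (var x) = e x
rename-subst e (con c) = refl
rename-subst e (app t u) = cong₂ app (rename-subst e t) (rename-subst e u)
rename-subst {θ = θ} {ρ} {θ′} e (lam t) = cong lam (rename-subst e′ t)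
  where
  e′ : ∀ {τ} (x : _ ∋ τ) → rename (ext ρ) (exts θ x) ≡ exts θ′ x
  e′ here = refl
  e′ (there x) = trans (rename-∘ (λ _ → refl) (θ x)) (trans (sym (rename-∘ (λ _ → refl) (θ x))) (cong wk (e x)))

subst-∘ : {θ : Sub Γ Δ} {θ′ : Sub Δ Θ} {θ″ : Sub Γ Θ} → (∀ {τ} (x : Γ ∋ τ) → subst θ′ (θ x) ≡ θ″ x) →
          (t : Tm Γ τ) → subst θ′ (subst θ t) ≡ subst θ″ t
subst-∘ e (var x) = e x
subst-∘ e (con c) = refl
subst-∘ e (app t u) = cong₂ app (subst-∘ e t) (subst-∘ e u)
subst-∘ {θ = θ} {θ′} {θ″} e (lam t) = cong lam (subst-∘ e′ t)
  where
  e′ : ∀ {τ} (x : _ ∋ τ) → subst (exts θ′) (exts θ x) ≡ exts θ″ x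
  e′ here = refl
  e′ (there x) = trans (subst-rename (λ _ → refl) (θ x)) (trans (sym (rename-subst (λ _ → refl) (θ x))) (cong wk (e x)))

subst-id : {θ : Sub Γ Γ} → (∀ {τ} (x : Γ ∋ τ) → θ x ≡ var x) → (t : Tm Γ τ) → subst θ t ≡ t
subst-id e (var x) = e x
subst-id e (con c) = refl
subst-id e (app t u) = cong₂ app (subst-id e t) (subst-id e u)
subst-id {θ = θ} e (lam t) = cong lam (subst-id e′ t)
  where
  e′ : ∀ {τ} (x : _ ∋ τ) → exts θ x ≡ var x
  e′ here = refl
  e′ (there x) = cong wk (e x)

subst-var≡rename : {ρ : Ren Γ Δ} (t : Tm Γ τ) → subst (λ x → var (ρ x)) t ≡ rename ρ t
subst-var≡rename {ρ = ρ} t = trans (sym (subst-rename {ρ = ρ} {θ = var} (λ _ → refl) t)) (subst-id (λ _ → refl) (rename ρ t))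

wk-[] : (t : Tm Γ τ) (u : Tm Γ σ) → wk t [ u ] ≡ t
wk-[] t u = trans (subst-rename (λ _ → refl) t) (subst-id (λ _ → refl) t)

subst-exts-wk : (θ : Sub Γ Δ) (t : Tm Γ τ) → subst (exts {σ = σ} θ) (wk t) ≡ wk (subst θ t)
subst-exts-wk θ t = trans (subst-rename (λ _ → refl) t) (sym (rename-subst (λ _ → refl) t))

rename-ext-wk : (ρ : Ren Γ Δ) (t : Tm Γ τ) → rename (ext {σ = σ} ρ) (wk t) ≡ wk (rename ρ t)
rename-ext-wk ρ t = trans (rename-∘ (λ _ → refl) t) (sym (rename-∘ (λ _ → refl) t))

ext-there-[v0] : (t : Tm (τ ∷ Γ) σ) → rename (ext there) t [ var here ] ≡ t
ext-there-[v0] t = trans (subst-rename e t) (subst-id (λ _ → refl) t)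
  where
  e : ∀ {τ′} (x : _ ∋ τ′) → single (var here) (ext there x) ≡ var x
  e here = refl
  e (there x) = refl

rename-≈ : (ρ : Ren Γ Δ) {t u : Tm Γ τ} → t ≈ u → rename ρ t ≈ rename ρ u
rename-≈ ρ ≈refl = ≈refl
rename-≈ ρ (≈sym p) = ≈sym (rename-≈ ρ p)
rename-≈ ρ (≈trans p q) = ≈trans (rename-≈ ρ p) (rename-≈ ρ q)
rename-≈ ρ (app≈ p q) = app≈ (rename-≈ ρ p) (rename-≈ ρ q)
rename-≈ ρ (lam≈ p) = lam≈ (rename-≈ (ext ρ) p)
rename-≈ ρ (β≈ t u) = ≈trans (β≈ _ _) (≡⇒≈ (trans (subst-rename (λ _ → refl) t) (sym (rename-subst e t))))
  where
  e : ∀ {τ′} (x : _ ∋ τ′) → rename ρ (single u x) ≡ single (rename ρ u) (ext ρ x)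
  e here = refl
  e (there x) = refl
rename-≈ ρ (η≈ t) = ≈trans (lam≈ (app≈ (≡⇒≈ (rename-ext-wk ρ t)) ≈refl)) (η≈ (rename ρ t))

subst-≈ : (θ : Sub Γ Δ) {t u : Tm Γ τ} → t ≈ u → subst θ t ≈ subst θ u
subst-≈ θ ≈refl = ≈refl
subst-≈ θ (≈sym p) = ≈sym (subst-≈ θ p)
subst-≈ θ (≈trans p q) = ≈trans (subst-≈ θ p) (subst-≈ θ q)
subst-≈ θ (app≈ p q) = app≈ (subst-≈ θ p) (subst-≈ θ q)
subst-≈ θ (lam≈ p) = lam≈ (subst-≈ (exts θ) p)
subst-≈ θ (β≈ t u) = ≈trans (β≈ _ _) (≡⇒≈ (trans (subst-∘ e t) (sym (subst-∘ (λ _ → refl) t))))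
  where
  e : ∀ {τ′} (x : _ ∋ τ′) → subst (single (subst θ u)) (exts θ x) ≡ subst θ (single u x)
  e here = refl
  e (there x) = wk-[] (θ x) _
subst-≈ θ (η≈ t) = ≈trans (lam≈ (app≈ (≡⇒≈ (subst-exts-wk θ t)) ≈refl)) (η≈ (subst θ t))

-- Normalisation by evaluation

data Ne (Γ : Ctx) : Ty → Set
data Nf (Γ : Ctx) : Ty → Set
data Ne Γ where
  nvar : Γ ∋ τ → Ne Γ τ
  ncon : Const τ → Ne Γ τ
  napp : Ne Γ (τ ⇒ σ) → Nf Γ τ → Ne Γ σ
data Nf Γ where
  nne  : Ne Γ (ι b) → Nf Γ (ι b)
  nlam : Nf (τ ∷ Γ) σ → Nf Γ (τ ⇒ σ)

renNe : Ren Γ Δ → Ne Γ τ → Ne Δ τ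
renNf : Ren Γ Δ → Nf Γ τ → Nf Δ τ
renNe ρ (nvar x) = nvar (ρ x)
renNe ρ (ncon c) = ncon c
renNe ρ (napp n m) = napp (renNe ρ n) (renNf ρ m)
renNf ρ (nne n) = nne (renNe ρ n)
renNf ρ (nlam m) = nlam (renNf (ext ρ) m)

embNe : Ne Γ τ → Tm Γ τ
embNf : Nf Γ τ → Tm Γ τ
embNe (nvar x) = var x
embNe (ncon c) = con c
embNe (napp n m) = app (embNe n) (embNf m)
embNf (nne n) = embNe n
embNf (nlam m) = lam (embNf m)

renNe-∘ : {ρ : Ren Γ Δ} {ρ′ : Ren Δ Θ} {ρ″ : Ren Γ Θ} → (∀ {τ} (x : Γ ∋ τ) → ρ′ (ρ x) ≡ ρ″ x) →
          (n : Ne Γ τ) → renNe ρ′ (renNe ρ n) ≡ renNe ρ″ n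
renNf-∘ : {ρ : Ren Γ Δ} {ρ′ : Ren Δ Θ} {ρ″ : Ren Γ Θ} → (∀ {τ} (x : Γ ∋ τ) → ρ′ (ρ x) ≡ ρ″ x) →
          (n : Nf Γ τ) → renNf ρ′ (renNf ρ n) ≡ renNf ρ″ n
renNe-∘ e (nvar x) = cong nvar (e x)
renNe-∘ e (ncon c) = refl
renNe-∘ e (napp n m) = cong₂ napp (renNe-∘ e n) (renNf-∘ e m)
renNf-∘ e (nne n) = cong nne (renNe-∘ e n)
renNf-∘ {ρ = ρ} {ρ′} {ρ″} e (nlam m) = cong nlam (renNf-∘ e′ m)
  where
  e′ : ∀ {τ} (x : _ ∋ τ) → ext ρ′ (ext ρ x) ≡ ext ρ″ x
  e′ here = refl
  e′ (there x) = cong there (e x)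

renNe-id : {ρ : Ren Γ Γ} → (∀ {τ} (x : Γ ∋ τ) → ρ x ≡ x) → (n : Ne Γ τ) → renNe ρ n ≡ n
renNf-id : {ρ : Ren Γ Γ} → (∀ {τ} (x : Γ ∋ τ) → ρ x ≡ x) → (n : Nf Γ τ) → renNf ρ n ≡ n
renNe-id e (nvar x) = cong nvar (e x)
renNe-id e (ncon c) = refl
renNe-id e (napp n m) = cong₂ napp (renNe-id e n) (renNf-id e m)
renNf-id e (nne n) = cong nne (renNe-id e n)
renNf-id {ρ = ρ} e (nlam m) = cong nlam (renNf-id e′ m)
  where
  e′ : ∀ {τ} (x : _ ∋ τ) → ext ρ x ≡ x
  e′ here = refl
  e′ (there x) = cong there (e x)

embNe-renNe : (ρ : Ren Γ Δ) (n : Ne Γ τ) → embNe (renNe ρ n) ≡ rename ρ (embNe n)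
embNf-renNf : (ρ : Ren Γ Δ) (n : Nf Γ τ) → embNf (renNf ρ n) ≡ rename ρ (embNf n)
embNe-renNe ρ (nvar x) = refl
embNe-renNe ρ (ncon c) = refl
embNe-renNe ρ (napp n m) = cong₂ app (embNe-renNe ρ n) (embNf-renNf ρ m)
embNf-renNf ρ (nne n) = embNe-renNe ρ n
embNf-renNf ρ (nlam m) = cong lam (embNf-renNf (ext ρ) m)

Val : Ctx → Ty → Set
Val Γ (ι b) = Ne Γ (ι b)
Val Γ (τ ⇒ σ) = ∀ {Δ} → Ren Γ Δ → Val Δ τ → Val Δ σ

renVal : Ren Γ Δ → Val Γ τ → Val Δ τ
renVal {τ = ι b} ρ v = renNe ρ v
renVal {τ = τ ⇒ σ} ρ f = λ ρ′ a → f (λ x → ρ′ (ρ x)) a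

reflect : Ne Γ τ → Val Γ τ
reify : Val Γ τ → Nf Γ τ
reflect {τ = ι b} n = n
reflect {τ = τ ⇒ σ} n = λ ρ a → reflect (napp (renNe ρ n) (reify a))
reify {τ = ι b} v = nne v
reify {τ = τ ⇒ σ} f = nlam (reify (f there (reflect (nvar here))))

Env : Ctx → Ctx → Set
Env Γ Δ = ∀ {τ} → Γ ∋ τ → Val Δ τ

_,,_ : Env Γ Δ → Val Δ τ → Env (τ ∷ Γ) Δ
(γ ,, a) here = a
(γ ,, a) (there x) = γ x

renEnv : Ren Δ Δ′ → Env Γ Δ → Env Γ Δ′
renEnv ρ γ x = renVal ρ (γ x)

eval : Tm Γ τ → Env Γ Δ → Val Δ τ
eval (var x) γ = γ x
eval (con c) γ = reflect (ncon c)
eval (app t u) γ = eval t γ (λ x → x) (eval u γ)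
eval (lam t) γ = λ ρ a → eval t (renEnv ρ γ ,, a)

nf : Tm Γ τ → Nf Γ τ
nf t = reify (eval t (λ x → reflect (nvar x)))

infix 4 _~_
_~_ : Val Γ τ → Val Γ τ → Set
_~_ {Γ} {ι b} v w = v ≡ w
_~_ {Γ} {τ ⇒ σ} f g =
  (∀ {Δ} (ρ : Ren Γ Δ) {a b : Val Δ τ} → a ~ b → f ρ a ~ g ρ b) ×
  (∀ {Δ Δ′} (ρ : Ren Γ Δ) (ρ′ : Ren Δ Δ′) (a : Val Δ τ) → a ~ a → renVal ρ′ (f ρ a) ~ f (λ x → ρ′ (ρ x)) (renVal ρ′ a)) ×
  (∀ {Δ Δ′} (ρ : Ren Γ Δ) (ρ′ : Ren Δ Δ′) (a : Val Δ τ) → a ~ a → renVal ρ′ (g ρ a) ~ g (λ x → ρ′ (ρ x)) (renVal ρ′ a))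

~-sym : {a b : Val Γ τ} → a ~ b → b ~ a
~-trans : {a b c : Val Γ τ} → a ~ b → b ~ c → a ~ c
~-sym {τ = ι b} p = sym p
~-sym {τ = τ ⇒ σ} (p , uf , ug) = (λ ρ ab → ~-sym (p ρ (~-sym ab))) , ug , uf
~-trans {τ = ι b} p q = trans p q
~-trans {τ = τ ⇒ σ} (p , uf , _) (q , _ , uh) =
  (λ ρ ab → ~-trans (p ρ (~-trans ab (~-sym ab))) (q ρ ab)) , uf , uh

~-reflˡ : {a b : Val Γ τ} → a ~ b → a ~ a
~-reflˡ p = ~-trans p (~-sym p)

~-reflʳ : {a b : Val Γ τ} → a ~ b → b ~ b
~-reflʳ p = ~-trans (~-sym p) p

renVal-~ : (ρ : Ren Γ Δ) {a b : Val Γ τ} → a ~ b → renVal ρ a ~ renVal ρ b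
renVal-~ {τ = ι b} ρ p = cong (renNe ρ) p
renVal-~ {τ = τ ⇒ σ} ρ (p , uf , ug) =
  (λ ρ′ ab → p (λ x → ρ′ (ρ x)) ab) , (λ ρ′ ρ″ a aa → uf (λ x → ρ′ (ρ x)) ρ″ a aa) ,
  (λ ρ′ ρ″ a aa → ug (λ x → ρ′ (ρ x)) ρ″ a aa)

renVal-∘ : (ρ : Ren Γ Δ) (ρ′ : Ren Δ Θ) {a : Val Γ τ} → a ~ a →
           renVal ρ′ (renVal ρ a) ~ renVal (λ x → ρ′ (ρ x)) a
renVal-∘ {τ = ι b} ρ ρ′ {a} p = renNe-∘ (λ _ → refl) a
renVal-∘ {τ = τ ⇒ σ} ρ ρ′ p = renVal-~ (λ x → ρ′ (ρ x)) p

renVal-id : {a : Val Γ τ} → a ~ a → renVal (λ x → x) a ~ a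
renVal-id {τ = ι b} {a} p = renNe-id (λ _ → refl) a
renVal-id {τ = τ ⇒ σ} p = p

reflect-~ : (n : Ne Γ τ) → reflect n ~ reflect n
renVal-reflect : (ρ : Ren Γ Δ) (n : Ne Γ τ) → renVal ρ (reflect n) ~ reflect (renNe ρ n)
reify-~ : {a b : Val Γ τ} → a ~ b → reify a ≡ reify b
renNf-reify : (ρ : Ren Γ Δ) {a : Val Γ τ} → a ~ a → renNf ρ (reify a) ≡ reify (renVal ρ a)

reflect-≡ : {n n′ : Ne Γ τ} → n ≡ n′ → reflect n ~ reflect n′
reflect-≡ {n = n} refl = reflect-~ n

reflect-~ {τ = ι b} n = refl
reflect-~ {τ = τ ⇒ σ} n = (λ ρ ab → reflect-≡ (cong (napp (renNe ρ n)) (reify-~ ab))) , natural , natural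
  where
  natural : ∀ {Δ Δ′} (ρ : Ren _ Δ) (ρ′ : Ren Δ Δ′) (a : Val Δ τ) → a ~ a →
            renVal ρ′ (reflect (napp (renNe ρ n) (reify a))) ~ reflect (napp (renNe (λ x → ρ′ (ρ x)) n) (reify (renVal ρ′ a)))
  natural ρ ρ′ a aa = ~-trans (renVal-reflect ρ′ _) (reflect-≡ (cong₂ napp (renNe-∘ (λ _ → refl) n) (renNf-reify ρ′ aa)))

renVal-reflect {τ = ι b} ρ n = refl
renVal-reflect {τ = τ ⇒ σ} ρ n =
  (λ ρ′ ab → reflect-≡ (cong₂ napp (sym (renNe-∘ (λ _ → refl) n)) (reify-~ ab))) ,
  proj₁ (proj₂ (renVal-~ ρ (reflect-~ n))) , proj₁ (proj₂ (reflect-~ (renNe ρ n)))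

reify-~ {τ = ι b} p = cong nne p
reify-~ {τ = τ ⇒ σ} (p , _ , _) = cong nlam (reify-~ (p there (reflect-~ (nvar here))))

renNf-reify {τ = ι b} ρ aa = refl
renNf-reify {τ = τ ⇒ σ} ρ (p , uf , _) =
  cong nlam (trans (renNf-reify (ext ρ) (p there (reflect-~ (nvar here))))
             (reify-~ (~-trans (uf there (ext ρ) (reflect (nvar here)) (reflect-~ (nvar here)))
                               (p (λ x → there (ρ x)) (renVal-reflect (ext ρ) (nvar here))))))

Env~ : Env Γ Δ → Env Γ Δ → Set
Env~ {Γ} γ γ′ = ∀ {τ} (x : Γ ∋ τ) → γ x ~ γ′ x

Env~-,, : {γ γ′ : Env Γ Δ} {a b : Val Δ τ} → Env~ γ γ′ → a ~ b → Env~ (γ ,, a) (γ′ ,, b)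
Env~-,, e ab here = ab
Env~-,, e ab (there x) = e x

Env~-renEnv : (ρ : Ren Δ Δ′) {γ γ′ : Env Γ Δ} → Env~ γ γ′ → Env~ (renEnv ρ γ) (renEnv ρ γ′)
Env~-renEnv ρ e x = renVal-~ ρ (e x)

eval-~ : (t : Tm Γ τ) {γ γ′ : Env Γ Δ} → Env~ γ γ′ → eval t γ ~ eval t γ′
renVal-eval : (t : Tm Γ τ) (ρ : Ren Δ Δ′) {γ : Env Γ Δ} → Env~ γ γ → renVal ρ (eval t γ) ~ eval t (renEnv ρ γ)

eval-lam-natural : (t : Tm (τ ∷ Γ) σ) {γ : Env Γ Δ} → Env~ γ γ →
  ∀ {Δ₁ Δ₂} (ρ : Ren Δ Δ₁) (ρ′ : Ren Δ₁ Δ₂) (a : Val Δ₁ τ) → a ~ a →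
  renVal ρ′ (eval t (renEnv ρ γ ,, a)) ~ eval t (renEnv (λ x → ρ′ (ρ x)) γ ,, renVal ρ′ a)
eval-lam-natural t {γ} e ρ ρ′ a aa = ~-trans (renVal-eval t ρ′ (Env~-,, (Env~-renEnv ρ e) aa)) (eval-~ t pw)
  where
  pw : Env~ (renEnv ρ′ (renEnv ρ γ ,, a)) (renEnv (λ x → ρ′ (ρ x)) γ ,, renVal ρ′ a)
  pw here = renVal-~ ρ′ aa
  pw (there x) = renVal-∘ ρ ρ′ (e x)

eval-~ (var x) e = e x
eval-~ (con c) e = reflect-~ (ncon c)
eval-~ (app t u) e = proj₁ (eval-~ t e) (λ x → x) (eval-~ u e)
eval-~ (lam t) e =
  (λ ρ ab → eval-~ t (Env~-,, (Env~-renEnv ρ e) ab)) ,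
  eval-lam-natural t (λ x → ~-reflˡ (e x)) , eval-lam-natural t (λ x → ~-reflʳ (e x))

renVal-eval (var x) ρ e = renVal-~ ρ (e x)
renVal-eval (con c) ρ e = renVal-reflect ρ (ncon c)
renVal-eval (app t u) ρ {γ} e =
  ~-trans (proj₁ (proj₂ (eval-~ t e)) (λ x → x) ρ (eval u γ) (eval-~ u e))
          (proj₁ (renVal-eval t ρ e) (λ x → x) (renVal-eval u ρ e))
renVal-eval (lam t) ρ e =
  (λ ρ′ ab → eval-~ t (Env~-,, (λ x → ~-sym (renVal-∘ ρ ρ′ (e x))) ab)) ,
  proj₁ (proj₂ (renVal-~ ρ (eval-~ (lam t) e))) ,
  proj₁ (proj₂ (eval-~ (lam t) (Env~-renEnv ρ e)))

eval-rename : (t : Tm Γ τ) (ρ : Ren Γ Θ) {γ γ′ : Env Θ Δ} → Env~ γ γ′ → eval (rename ρ t) γ ~ eval t (λ x → γ′ (ρ x))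
eval-rename (var x) ρ e = e (ρ x)
eval-rename (con c) ρ e = reflect-~ (ncon c)
eval-rename (app t u) ρ e = proj₁ (eval-rename t ρ e) (λ x → x) (eval-rename u ρ e)
eval-rename {Γ = Γ} {Δ = Δ} (lam {τ = τ₀} t) ρ {γ} {γ′} e =
  (λ ρ′ ab → ~-trans (eval-rename t (ext ρ) (Env~-,, (Env~-renEnv ρ′ e) ab)) (eval-~ t (pw ρ′ (~-reflʳ ab)))) ,
  eval-lam-natural (rename (ext ρ) t) (λ x → ~-reflˡ (e x)) ,
  eval-lam-natural t (λ x → ~-reflʳ (e (ρ x)))
  where
  pw : ∀ {Δ₁} (ρ′ : Ren Δ Δ₁) {b : Val Δ₁ τ₀} → b ~ b →
       Env~ {τ₀ ∷ Γ} (λ x → (renEnv ρ′ γ′ ,, b) (ext ρ x)) (renEnv ρ′ (λ x → γ′ (ρ x)) ,, b)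
  pw ρ′ bb here = bb
  pw ρ′ bb (there x) = renVal-~ ρ′ (~-reflʳ (e (ρ x)))

eval-subst : (t : Tm Γ τ) (θ : Sub Γ Θ) {γ γ′ : Env Θ Δ} → Env~ γ γ′ → eval (subst θ t) γ ~ eval t (λ x → eval (θ x) γ′)
eval-subst (var x) θ e = eval-~ (θ x) e
eval-subst (con c) θ e = reflect-~ (ncon c)
eval-subst (app t u) θ e = proj₁ (eval-subst t θ e) (λ x → x) (eval-subst u θ e)
eval-subst {Γ = Γ} {Δ = Δ} (lam {τ = τ₀} t) θ {γ} {γ′} e =
  (λ ρ′ ab → ~-trans (eval-subst t (exts θ) (Env~-,, (Env~-renEnv ρ′ e) ab)) (eval-~ t (pw ρ′ (~-reflʳ ab)))) ,
  eval-lam-natural (subst (exts θ) t) (λ x → ~-reflˡ (e x)) ,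
  eval-lam-natural t (λ x → eval-~ (θ x) e′)
  where
  e′ : Env~ γ′ γ′
  e′ y = ~-reflʳ (e y)
  pw : ∀ {Δ₁} (ρ′ : Ren Δ Δ₁) {b : Val Δ₁ τ₀} → b ~ b →
       Env~ {τ₀ ∷ Γ} (λ x → eval (exts θ x) (renEnv ρ′ γ′ ,, b)) (renEnv ρ′ (λ x → eval (θ x) γ′) ,, b)
  pw ρ′ bb here = bb
  pw ρ′ bb (there x) = ~-trans (eval-rename (θ x) there (Env~-,, (Env~-renEnv ρ′ e′) bb)) (~-sym (renVal-eval (θ x) ρ′ e′))

≈⇒eval-~ : {t u : Tm Γ τ} → t ≈ u → {γ γ′ : Env Γ Δ} → Env~ γ γ′ → eval t γ ~ eval u γ′
≈⇒eval-~ {t = t} ≈refl e = eval-~ t e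
≈⇒eval-~ (≈sym p) e = ~-sym (≈⇒eval-~ p (λ x → ~-sym (e x)))
≈⇒eval-~ (≈trans p q) e = ~-trans (≈⇒eval-~ p e) (≈⇒eval-~ q (λ x → ~-reflʳ (e x)))
≈⇒eval-~ (app≈ p q) e = proj₁ (≈⇒eval-~ p e) (λ x → x) (≈⇒eval-~ q e)
≈⇒eval-~ (lam≈ {t = t} {t′} p) e =
  (λ ρ ab → ≈⇒eval-~ p (Env~-,, (Env~-renEnv ρ e) ab)) ,
  eval-lam-natural t (λ x → ~-reflˡ (e x)) , eval-lam-natural t′ (λ x → ~-reflʳ (e x))
≈⇒eval-~ (β≈ t u) {γ} e = ~-sym (~-trans (eval-subst t (single u) (λ x → ~-sym (e x))) (eval-~ t pw))
  where
  pw : Env~ (λ x → eval (single u x) γ) (renEnv (λ x → x) γ ,, eval u γ)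
  pw here = eval-~ u (λ x → ~-reflˡ (e x))
  pw (there x) = ~-sym (renVal-id (~-reflˡ (e x)))
≈⇒eval-~ (η≈ t) e =
  (λ ρ ab → proj₁
     (~-trans (eval-rename t there (Env~-,, (Env~-renEnv ρ (λ x → ~-reflˡ (e x))) (~-reflˡ ab)))
              (~-trans (~-sym (renVal-eval t ρ (λ x → ~-reflˡ (e x)))) (renVal-~ ρ (eval-~ t e))))
     (λ x → x) ab) ,
  proj₁ (proj₂ (eval-~ (lam (app (wk t) (var here))) (λ x → ~-reflˡ (e x)))) ,
  proj₁ (proj₂ (eval-~ t (λ x → ~-reflʳ (e x))))

≈⇒nf≡ : {t u : Tm Γ τ} → t ≈ u → nf t ≡ nf u
≈⇒nf≡ p = reify-~ (≈⇒eval-~ p (λ x → reflect-~ (nvar x)))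

_⊩_ : Tm Γ τ → Val Γ τ → Set
_⊩_ {Γ} {ι b} t v = t ≈ embNe v
_⊩_ {Γ} {τ ⇒ σ} t f = ∀ {Δ} (ρ : Ren Γ Δ) {u : Tm Δ τ} {a : Val Δ τ} → u ⊩ a → app (rename ρ t) u ⊩ f ρ a

⊩-≈ : {t t′ : Tm Γ τ} {v : Val Γ τ} → t ≈ t′ → t ⊩ v → t′ ⊩ v
⊩-≈ {τ = ι b} p r = ≈trans (≈sym p) r
⊩-≈ {τ = τ ⇒ σ} p r ρ ua = ⊩-≈ (app≈ (rename-≈ ρ p) ≈refl) (r ρ ua)

⊩-rename : (ρ : Ren Γ Δ) {t : Tm Γ τ} {v : Val Γ τ} → t ⊩ v → rename ρ t ⊩ renVal ρ v
⊩-rename {τ = ι b} ρ {v = v} r = ≈trans (rename-≈ ρ r) (≡⇒≈ (sym (embNe-renNe ρ v)))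
⊩-rename {τ = τ ⇒ σ} ρ {t} r ρ′ ua = ⊩-≈ (app≈ (≡⇒≈ (sym (rename-∘ (λ _ → refl) t))) ≈refl) (r (λ x → ρ′ (ρ x)) ua)

reflect-⊩ : (n : Ne Γ τ) → embNe n ⊩ reflect n
reify-⊩ : {t : Tm Γ τ} {v : Val Γ τ} → t ⊩ v → t ≈ embNf (reify v)
reflect-⊩ {τ = ι b} n = ≈refl
reflect-⊩ {τ = τ ⇒ σ} n ρ {a = a} ua =
  ⊩-≈ (app≈ (≡⇒≈ (embNe-renNe ρ n)) (≈sym (reify-⊩ ua))) (reflect-⊩ (napp (renNe ρ n) (reify a)))
reify-⊩ {τ = ι b} r = r
reify-⊩ {τ = τ ⇒ σ} {t} r = ≈trans (≈sym (η≈ t)) (lam≈ (reify-⊩ (r there (reflect-⊩ (nvar here)))))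

subst-⊩ : (t : Tm Γ τ) (θ : Sub Γ Θ) {γ : Env Γ Θ} → (∀ {τ} (x : Γ ∋ τ) → θ x ⊩ γ x) → subst θ t ⊩ eval t γ
subst-⊩ (var x) θ r = r x
subst-⊩ (con c) θ r = reflect-⊩ (ncon c)
subst-⊩ (app t u) θ r = ⊩-≈ (app≈ (≡⇒≈ (rename-id (λ _ → refl) (subst θ t))) ≈refl) (subst-⊩ t θ r (λ x → x) (subst-⊩ u θ r))
subst-⊩ (lam t) θ {γ} r ρ {u} {a} ua = ⊩-≈ (≈sym (≈trans (β≈ _ _) (≡⇒≈ eq))) (subst-⊩ t θ′ r′)
  where
  θ′ : Sub _ _
  θ′ here = u
  θ′ (there x) = rename ρ (θ x)
  r′ : ∀ {τ} (x : _ ∋ τ) → θ′ x ⊩ (renEnv ρ γ ,, a) x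
  r′ here = ua
  r′ (there x) = ⊩-rename ρ (r x)
  e : ∀ {τ} (x : _ ∋ τ) → subst (λ y → single u (ext ρ y)) (exts θ x) ≡ θ′ x
  e here = refl
  e (there x) = trans (subst-rename (λ _ → refl) (θ x)) (subst-var≡rename (θ x))
  eq : subst (single u) (rename (ext ρ) (subst (exts θ) t)) ≡ subst θ′ t
  eq = trans (subst-rename (λ _ → refl) (subst (exts θ) t)) (subst-∘ e t)

nf-sound : (t : Tm Γ τ) → t ≈ embNf (nf t)
nf-sound t = reify-⊩ (⊩-≈ (≡⇒≈ (subst-id (λ _ → refl) t)) (subst-⊩ t var (λ x → reflect-⊩ (nvar x))))

nf≡⇒≈ : {t u : Tm Γ τ} → nf t ≡ nf u → t ≈ u
nf≡⇒≈ {t = t} {u} e = ≈trans (nf-sound t) (≈trans (≡⇒≈ (cong embNf e)) (≈sym (nf-sound u)))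

headNe : Ne Γ τ → Maybe (∃ Const)
headNe (nvar x) = nothing
headNe (ncon c) = just (_ , c)
headNe (napp n m) = headNe n

headNf : Nf Γ (ι b) → Maybe (∃ Const)
headNf (nne n) = headNe n

-- On a constant-headed term, headConst computes to the head constant even under an unknown
-- substitution, so atoms with different heads are told apart by an absurd pattern.
headConst : Tm Γ (ι b) → Maybe (∃ Const)
headConst t = headNf (nf t)

≈⇒headConst≡ : {t u : Tm Γ (ι b)} → t ≈ u → headConst t ≡ headConst u
≈⇒headConst≡ p = cong headNf (≈⇒nf≡ p)

headConst-≢⇒≉ : {t u : Tm Γ (ι b)} → headConst t ≢ headConst u → t ≈ u → ⊥
headConst-≢⇒≉ heads≢ p = heads≢ (≈⇒headConst≡ p)

nne-injective : {n m : Ne Γ (ι b)} → nne n ≡ nne m → n ≡ m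
nne-injective refl = refl

napp-injective : {f g : Ne Γ (τ ⇒ σ)} {a c : Nf Γ τ} → napp f a ≡ napp g c → f ≡ g × a ≡ c
napp-injective refl = refl , refl

renNf-id-injective : {n m : Nf Γ τ} → renNf (λ x → x) n ≡ renNf (λ x → x) m → n ≡ m
renNf-id-injective {n = n} {m} e = trans (sym (renNf-id (λ _ → refl) n)) (trans e (renNf-id (λ _ → refl) m))

con-app-injective : {τ₁ : Ty} (c : Const (τ₁ ⇒ ι b)) {a a′ : Tm Γ τ₁} → con c · a ≈ con c · a′ → a ≈ a′
con-app-injective c e = nf≡⇒≈ (proj₂ (napp-injective (nne-injective (≈⇒nf≡ e))))

con-app₂-injective : {τ₁ τ₂ : Ty} (c : Const (τ₁ ⇒ τ₂ ⇒ ι b)) {a a′ : Tm Γ τ₁} {d d′ : Tm Γ τ₂} →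
                     con c · a · d ≈ con c · a′ · d′ → a ≈ a′ × d ≈ d′
con-app₂-injective c e with napp-injective (nne-injective (≈⇒nf≡ e))
... | e₁ , e₂ = nf≡⇒≈ (renNf-id-injective (proj₂ (napp-injective e₁))) , nf≡⇒≈ e₂

con-app₃-injective : {τ₁ τ₂ τ₃ : Ty} (c : Const (τ₁ ⇒ τ₂ ⇒ τ₃ ⇒ ι b)) {a a′ : Tm Γ τ₁} {d d′ : Tm Γ τ₂} {f f′ : Tm Γ τ₃} →
                     con c · a · d · f ≈ con c · a′ · d′ · f′ → a ≈ a′ × d ≈ d′ × f ≈ f′
con-app₃-injective c e with napp-injective (nne-injective (≈⇒nf≡ e))
... | e₁ , e₂ with napp-injective e₁
... | e₃ , e₄ = nf≡⇒≈ (renNf-id-injective (renNf-id-injective (proj₂ (napp-injective e₃)))) ,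
                nf≡⇒≈ (renNf-id-injective e₄) , nf≡⇒≈ e₂

private variable
  G : List (Form Γ)
  A A′ B C C′ : Form Γ

≈-refl* : Pointwise _≈_ G G
≈-refl* = Pointwise.refl ≈refl

conv-goal : C ≈ C′ → Γ ⨾ G ⟶ C → Γ ⨾ G ⟶ C′
conv-goal e = conv ≈-refl* e

conv-hyp : A ≈ A′ → Γ ⨾ A ∷ G ⟶ C → Γ ⨾ A′ ∷ G ⟶ C
conv-hyp e = conv (e ∷ ≈-refl*) ≈refl

exch-swap : Γ ⨾ A ∷ B ∷ G ⟶ C → Γ ⨾ B ∷ A ∷ G ⟶ C
exch-swap = exch (swap _ _ ↭.refl)

exch-rot : {D : Form Γ} → Γ ⨾ D ∷ A ∷ B ∷ G ⟶ C → Γ ⨾ A ∷ B ∷ D ∷ G ⟶ C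
exch-rot {A = A} {B} {D = D} = exch (↭.trans (swap D A ↭.refl) (prep A (swap D B ↭.refl)))

wk-lam·v0 : (X : Tm (τ ∷ Γ) σ) → wk (lam X) · var here ≈ X
wk-lam·v0 X = ≈trans (β≈ _ _) (≡⇒≈ (ext-there-[v0] X))

module _ {p : NoO τ} {X : Form (τ ∷ Γ)} where

  allR-lam : τ ∷ Γ ⨾ map wk G ⟶ X → Γ ⨾ G ⟶ fall τ p (lam X)
  allR-lam d = allR (conv-goal (≈sym (wk-lam·v0 X)) d)

  allL-lam : (t : Tm Γ τ) → Γ ⨾ X [ t ] ∷ G ⟶ C → Γ ⨾ fall τ p (lam X) ∷ G ⟶ C
  allL-lam t d = allL t (conv-hyp (≈sym (β≈ X t)) d)

  exL-lam : τ ∷ Γ ⨾ X ∷ map wk G ⟶ wk C → Γ ⨾ fex τ p (lam X) ∷ G ⟶ C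
  exL-lam d = exL (conv-hyp (≈sym (wk-lam·v0 X)) d)

  exR-lam : (t : Tm Γ τ) → Γ ⨾ G ⟶ X [ t ] → Γ ⨾ G ⟶ fex τ p (lam X)
  exR-lam t d = exR t (conv-goal (≈sym (β≈ X t)) d)

seq-atomic : {n : Tm Γ Tnt} {l : Tm Γ Tlst} {p : Tm Γ Tprp} → Atomic (seq' n l p)
seq-atomic = arg (arg (arg (hd seqc (λ ()))))

element-atomic : {a : Tm Γ Tatm} {l : Tm Γ Tlst} → Atomic (element' a l)
element-atomic = arg (arg (hd elementc (λ ())))

nat-atomic : {n : Tm Γ Tnt} → Atomic (nat' n)
nat-atomic = arg (hd natc (λ ()))

init≈ : Atomic A → A′ ≈ A → A ≈ C → Γ ⨾ A′ ∷ G ⟶ C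
init≈ at e e′ = conv-goal e′ (conv-hyp (≈sym e) (init at))

::-cong : {a a′ : Tm Γ Tatm} {l l′ : Tm Γ Tlst} → a ≈ a′ → l ≈ l′ → (a :: l) ≈ (a′ :: l′)
::-cong e = app≈ (app≈ ≈refl e)

⟨⟩-cong : {a a′ : Tm Γ Tatm} → a ≈ a′ → ⟨ a ⟩ ≈ ⟨ a′ ⟩
⟨⟩-cong = app≈ ≈refl

element'-cong : {a a′ : Tm Γ Tatm} {l l′ : Tm Γ Tlst} → a ≈ a′ → l ≈ l′ → element' a l ≈ element' a′ l′
element'-cong e = app≈ (app≈ ≈refl e)

seq'-cong : {n n′ : Tm Γ Tnt} {l l′ : Tm Γ Tlst} {p p′ : Tm Γ Tprp} →
            n ≈ n′ → l ≈ l′ → p ≈ p′ → seq' n l p ≈ seq' n′ l′ p′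
seq'-cong e₁ e₂ = app≈ (app≈ (app≈ ≈refl e₁) e₂)

infixr 5 _∷ₛ_
_∷ₛ_ : Tm Δ τ → Sub Γ Δ → Sub (τ ∷ Γ) Δ
(t ∷ₛ θ) here = t
(t ∷ₛ θ) (there x) = θ x

[]ₛ : Sub [] Δ
[]ₛ ()

defR-at : (n : Fin (length 𝒟)) (θ : Sub (vars (lookup 𝒟 n)) Γ) →
          Γ ⨾ G ⟶ subst θ (body (lookup 𝒟 n)) → Γ ⨾ G ⟶ subst θ (head (lookup 𝒟 n))
defR-at n = defR _ (∈-lookup n)

seq-atomR : {K : Tm Γ Tnt} {X A : Tm Γ Tatm} {L : Tm Γ Tlst} →
            Γ ⨾ G ⟶ element' A (X :: L) → Γ ⨾ G ⟶ seq' K (X :: L) ⟨ A ⟩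
seq-atomR {K = K} {X} {A} {L} = defR-at (# 17) (K ∷ₛ X ∷ₛ L ∷ₛ A ∷ₛ []ₛ)

seq-ttR : {K : Tm Γ Tnt} {L : Tm Γ Tlst} → Γ ⨾ G ⟶ seq' K L tt'
seq-ttR {K = K} {L} = defR-at (# 18) (K ∷ₛ L ∷ₛ []ₛ) topR

module _ {K : Tm Γ Tnt} {L : Tm Γ Tlst} where

  seq-andR : {P Q : Tm Γ Tprp} → Γ ⨾ G ⟶ fand (seq' K L P) (seq' K L Q) → Γ ⨾ G ⟶ seq' (s' K) L (P & Q)
  seq-andR {P = P} {Q} = defR-at (# 19) (K ∷ₛ L ∷ₛ P ∷ₛ Q ∷ₛ []ₛ)

  seq-impR : {A : Tm Γ Tatm} {P : Tm Γ Tprp} → Γ ⨾ G ⟶ seq' K (A :: L) P → Γ ⨾ G ⟶ seq' (s' K) L (A ⇛ P)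
  seq-impR {A = A} {P} = defR-at (# 20) (K ∷ₛ L ∷ₛ A ∷ₛ P ∷ₛ []ₛ)

  seq-allR : {P : Tm Γ (Ti ⇒ Tprp)} →
             Γ ⨾ G ⟶ fall Ti tt (lam (seq' (wk K) (wk L) (wk P · var here))) → Γ ⨾ G ⟶ seq' (s' K) L (⋀ P)
  seq-allR {P = P} = defR-at (# 21) (K ∷ₛ L ∷ₛ P ∷ₛ []ₛ)

element-hereR : {X : Tm Γ Tatm} {L : Tm Γ Tlst} → Γ ⨾ G ⟶ element' X (X :: L)
element-hereR {X = X} {L} = defR-at (# 10) (X ∷ₛ L ∷ₛ []ₛ) topR

element-thereR : {X Y : Tm Γ Tatm} {L : Tm Γ Tlst} → Γ ⨾ G ⟶ element' X L → Γ ⨾ G ⟶ element' X (Y :: L)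
element-thereR {X = X} {Y} {L} = defR-at (# 11) (X ∷ₛ Y ∷ₛ L ∷ₛ []ₛ)

allUnifiers : (A : Form Γ) (cl : Clause) → CSU A cl
allUnifiers A cl = record
  { mem = λ Δ θ₁ θ₂ → Unifier A cl θ₁ θ₂
  ; sound = λ u → u
  ; complete = λ Δ′ ρ₁ ρ₂ u → Δ′ , ρ₁ , ρ₂ , u , var ,
      (λ x → ≡⇒≈ (sym (subst-id (λ _ → refl) (ρ₁ x)))) ,
      (λ x → ≡⇒≈ (sym (subst-id (λ _ → refl) (ρ₂ x)))) }

record DefLPremise (G : List (Form Γ)) (C A : Form Γ) (cl : Clause) : Set₁ where
  constructor premise
  field
    run : ∀ {Δ} {θ₁ : Sub Γ Δ} {θ₂ : Sub (vars cl) Δ} →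
          Unifier A cl θ₁ θ₂ → Δ ⨾ subst θ₂ (body cl) ∷ map (subst θ₁) G ⟶ subst θ₁ C

-- Premises are given clause by clause in the order of 𝒟 and for every unifier, the set of all
-- unifiers being trivially complete.
defL-all : DefAtom A → All (DefLPremise G C A) 𝒟 → Γ ⨾ A ∷ G ⟶ C
defL-all {A = A} at ps = defL at (λ cl _ → allUnifiers A cl) (λ cl m → DefLPremise.run (All.lookup ps m))

clash : {cl : Clause} →
        (∀ {Δ} {θ₁ : Sub Γ Δ} {θ₂ : Sub (vars cl) Δ} → headConst (subst θ₁ A) ≢ headConst (subst θ₂ (head cl))) →
        DefLPremise G C A cl
clash heads≢ = premise (λ u → ⊥-elim (headConst-≢⇒≉ heads≢ u))

-- Inversion of defined atoms

progL : {a : Tm Γ Tatm} {p : Tm Γ Tprp} → Γ ⨾ prog' a p ∷ G ⟶ C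
progL = defL-all (arg (arg (hd progc ((λ ()) , (λ ())))))
  ( clash (λ ()) ∷ clash (λ ()) ∷ clash (λ ()) ∷ clash (λ ()) ∷ clash (λ ()) ∷ clash (λ ()) ∷ clash (λ ())
  ∷ clash (λ ()) ∷ clash (λ ()) ∷ clash (λ ()) ∷ clash (λ ()) ∷ clash (λ ()) ∷ clash (λ ()) ∷ clash (λ ())
  ∷ clash (λ ()) ∷ clash (λ ()) ∷ clash (λ ()) ∷ clash (λ ()) ∷ clash (λ ()) ∷ clash (λ ()) ∷ clash (λ ())
  ∷ clash (λ ()) ∷ clash (λ ()) ∷ [] )

record SeqInversion (G : List (Form Γ)) (C : Form Γ) (n : Tm Γ Tnt) (l : Tm Γ Tlst) (p : Tm Γ Tprp) : Set₁ where
  field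
    atom : ∀ {Δ} (θ : Sub Γ Δ) (x : Tm Δ Tatm) (L : Tm Δ Tlst) (a : Tm Δ Tatm) →
           subst θ l ≈ x :: L → subst θ p ≈ ⟨ a ⟩ →
           Δ ⨾ element' a (x :: L) ∷ map (subst θ) G ⟶ subst θ C
    true : ∀ {Δ} (θ : Sub Γ Δ) → subst θ p ≈ tt' → Δ ⨾ ftop ∷ map (subst θ) G ⟶ subst θ C
    and  : ∀ {Δ} (θ : Sub Γ Δ) (k : Tm Δ Tnt) (L : Tm Δ Tlst) (P Q : Tm Δ Tprp) →
           subst θ n ≈ s' k → subst θ l ≈ L → subst θ p ≈ P & Q →
           Δ ⨾ fand (seq' k L P) (seq' k L Q) ∷ map (subst θ) G ⟶ subst θ C
    imp  : ∀ {Δ} (θ : Sub Γ Δ) (k : Tm Δ Tnt) (L : Tm Δ Tlst) (A : Tm Δ Tatm) (P : Tm Δ Tprp) →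
           subst θ n ≈ s' k → subst θ l ≈ L → subst θ p ≈ A ⇛ P →
           Δ ⨾ seq' k (A :: L) P ∷ map (subst θ) G ⟶ subst θ C
    all  : ∀ {Δ} (θ : Sub Γ Δ) (k : Tm Δ Tnt) (L : Tm Δ Tlst) (P : Tm Δ (Ti ⇒ Tprp)) →
           subst θ n ≈ s' k → subst θ l ≈ L → subst θ p ≈ ⋀ P →
           Δ ⨾ fall Ti tt (lam (seq' (wk k) (wk L) (wk P · var here))) ∷ map (subst θ) G ⟶ subst θ C

-- The backchaining clause of seq never applies, since prog has no clauses.
seqL : {n : Tm Γ Tnt} {l : Tm Γ Tlst} {p : Tm Γ Tprp} → SeqInversion G C n l p → Γ ⨾ seq' n l p ∷ G ⟶ C
seqL cs = defL-all (arg (arg (arg (hd seqc ((λ ()) , (λ ()))))))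
  ( clash (λ ()) ∷ clash (λ ()) ∷ clash (λ ()) ∷ clash (λ ()) ∷ clash (λ ()) ∷ clash (λ ()) ∷ clash (λ ())
  ∷ clash (λ ()) ∷ clash (λ ()) ∷ clash (λ ()) ∷ clash (λ ()) ∷ clash (λ ()) ∷ clash (λ ()) ∷ clash (λ ())
  ∷ clash (λ ()) ∷ clash (λ ()) ∷ clash (λ ())
  ∷ premise (λ {θ₁ = θ} {θ₂} u → let _ , el , ep = con-app₃-injective seqc u in
       atom θ (θ₂ (there here)) (θ₂ (there (there here))) (θ₂ (there (there (there here)))) el ep)
  ∷ premise (λ {θ₁ = θ} u → true θ (proj₂ (proj₂ (con-app₃-injective seqc u))))
  ∷ premise (λ {θ₁ = θ} {θ₂} u → let en , el , ep = con-app₃-injective seqc u in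
       and θ (θ₂ here) (θ₂ (there here)) (θ₂ (there (there here))) (θ₂ (there (there (there here)))) en el ep)
  ∷ premise (λ {θ₁ = θ} {θ₂} u → let en , el , ep = con-app₃-injective seqc u in
       imp θ (θ₂ here) (θ₂ (there here)) (θ₂ (there (there here))) (θ₂ (there (there (there here)))) en el ep)
  ∷ premise (λ {θ₁ = θ} {θ₂} u → let en , el , ep = con-app₃-injective seqc u in
       all θ (θ₂ here) (θ₂ (there here)) (θ₂ (there (there here))) en el ep)
  ∷ premise (λ _ → exL-lam (andL₁ progL))
  ∷ [] )
  where open SeqInversion cs

record ElementInversion (G : List (Form Γ)) (C : Form Γ) (a : Tm Γ Tatm) (l : Tm Γ Tlst) : Set₁ where
  field
    atHead : ∀ {Δ} (θ : Sub Γ Δ) (X : Tm Δ Tatm) (L : Tm Δ Tlst) →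
             subst θ a ≈ X → subst θ l ≈ X :: L → Δ ⨾ ftop ∷ map (subst θ) G ⟶ subst θ C
    inTail : ∀ {Δ} (θ : Sub Γ Δ) (X Y : Tm Δ Tatm) (L : Tm Δ Tlst) →
             subst θ a ≈ X → subst θ l ≈ Y :: L → Δ ⨾ element' X L ∷ map (subst θ) G ⟶ subst θ C

elementL : {a : Tm Γ Tatm} {l : Tm Γ Tlst} → ElementInversion G C a l → Γ ⨾ element' a l ∷ G ⟶ C
elementL cs = defL-all (arg (arg (hd elementc ((λ ()) , (λ ())))))
  ( clash (λ ()) ∷ clash (λ ()) ∷ clash (λ ()) ∷ clash (λ ()) ∷ clash (λ ()) ∷ clash (λ ()) ∷ clash (λ ())
  ∷ clash (λ ()) ∷ clash (λ ()) ∷ clash (λ ())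
  ∷ premise (λ {θ₁ = θ} {θ₂} u → let ea , el = con-app₂-injective elementc u in
       atHead θ (θ₂ here) (θ₂ (there here)) ea el)
  ∷ premise (λ {θ₁ = θ} {θ₂} u → let ea , el = con-app₂-injective elementc u in
       inTail θ (θ₂ here) (θ₂ (there here)) (θ₂ (there (there here))) ea el)
  ∷ clash (λ ()) ∷ clash (λ ()) ∷ clash (λ ()) ∷ clash (λ ()) ∷ clash (λ ()) ∷ clash (λ ()) ∷ clash (λ ())
  ∷ clash (λ ()) ∷ clash (λ ()) ∷ clash (λ ()) ∷ clash (λ ()) ∷ [] )
  where open ElementInversion cs

infix 6 _⊆'_
_⊆'_ : Tm Γ Tlst → Tm Γ Tlst → Form Γ
L ⊆' L′ = fall Tatm tt (lam (fimp (element' (var here) (wk L)) (element' (var here) (wk L′))))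

module _ (L L′ : Tm Γ Tlst) where

  private
    ⊆'-under : Tm (Tatm ∷ Δ) Tlst → Tm (Tatm ∷ Δ) Tlst → Form Δ
    ⊆'-under M M′ = fall Tatm tt (lam (fimp (element' (var here) M) (element' (var here) M′)))

  ⊆'-subst : (θ : Sub Γ Δ) → subst θ (L ⊆' L′) ≡ subst θ L ⊆' subst θ L′
  ⊆'-subst θ = cong₂ ⊆'-under (subst-exts-wk θ L) (subst-exts-wk θ L′)

  ⊆'-wk : wk {σ = σ} (L ⊆' L′) ≡ wk L ⊆' wk L′
  ⊆'-wk = cong₂ ⊆'-under (rename-ext-wk there L) (rename-ext-wk there L′)

  ⊆'-[] : (A : Tm Γ Tatm) →
          fimp (element' (var here) (wk L)) (element' (var here) (wk L′)) [ A ] ≡ fimp (element' A L) (element' A L′)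
  ⊆'-[] A = cong₂ (λ M M′ → fimp (element' A M) (element' A M′)) (wk-[] L A) (wk-[] L′ A)

⊆'-apply : {A : Tm Γ Tatm} {L L′ : Tm Γ Tlst} → Γ ⨾ element' A L ∷ L ⊆' L′ ∷ G ⟶ element' A L′
⊆'-apply {A = A} {L} {L′} =
  exch-swap (allL-lam A (conv-hyp (≡⇒≈ (sym (⊆'-[] L L′ A))) (impL (init element-atomic) (init element-atomic))))

⊆'-axiom : {L L′ : Tm Γ Tlst} → Γ ⨾ L ⊆' L′ ∷ G ⟶ L ⊆' L′
⊆'-axiom {L = L} {L′} = allR-lam (conv-hyp (≡⇒≈ (sym (⊆'-wk L L′))) (impR ⊆'-apply))

element-cons-mono : {Y A : Tm Γ Tatm} {L L′ : Tm Γ Tlst} →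
                    Γ ⨾ element' Y (A :: L) ∷ L ⊆' L′ ∷ G ⟶ element' Y (A :: L′)
element-cons-mono {Y = Y} {A} {L} {L′} = elementL record
  { atHead = λ θ X M eY eL →
      conv-goal (element'-cong (≈sym eY) (::-cong (≈sym (proj₁ (con-app₂-injective consc eL))) ≈refl)) element-hereR
  ; inTail = λ θ X Z M eY eL →
      element-thereR (conv (element'-cong eY (proj₂ (con-app₂-injective consc eL))
                            ∷ ≡⇒≈ (sym (⊆'-subst L L′ θ)) ∷ ≈-refl*) ≈refl ⊆'-apply)
  }

⊆'-cons : {A : Tm Γ Tatm} {L L′ : Tm Γ Tlst} → Γ ⨾ L ⊆' L′ ∷ [] ⟶ (A :: L) ⊆' (A :: L′)
⊆'-cons {L = L} {L′} = allR-lam (conv-hyp (≡⇒≈ (sym (⊆'-wk L L′))) (impR element-cons-mono))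

element-cons-elim : {Y A : Tm Γ Tatm} {L : Tm Γ Tlst} → Γ ⨾ element' Y (A :: L) ∷ element' A L ∷ G ⟶ element' Y L
element-cons-elim = elementL record
  { atHead = λ θ X M eY eL →
      exch-swap (init≈ element-atomic ≈refl (element'-cong (≈trans (proj₁ (con-app₂-injective consc eL)) (≈sym eY)) ≈refl))
  ; inTail = λ θ X Z M eY eL →
      init≈ element-atomic ≈refl (element'-cong (≈sym eY) (≈sym (proj₂ (con-app₂-injective consc eL))))
  }

element⇒cons-⊆' : {A : Tm Γ Tatm} {L : Tm Γ Tlst} → Γ ⨾ element' A L ∷ [] ⟶ (A :: L) ⊆' L
element⇒cons-⊆' = allR-lam (impR element-cons-elim)

element-seq : {K : Tm Γ Tnt} {A : Tm Γ Tatm} {L : Tm Γ Tlst} → Γ ⨾ element' A L ∷ G ⟶ seq' K L ⟨ A ⟩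
element-seq = elementL record
  { atHead = λ θ X M eA eL → conv-goal (seq'-cong ≈refl (≈sym eL) (⟨⟩-cong (≈sym eA))) (seq-atomR element-hereR)
  ; inTail = λ θ X Y M eA eL →
      conv-goal (seq'-cong ≈refl (≈sym eL) (⟨⟩-cong (≈sym eA))) (seq-atomR (element-thereR (init element-atomic)))
  }

seq-obj⇒element : {K : Tm Γ Tnt} {A : Tm Γ Tatm} {L : Tm Γ Tlst} → Γ ⨾ seq' K L ⟨ A ⟩ ∷ G ⟶ element' A L
seq-obj⇒element = seqL record
  { atom = λ θ x M a eL eA →
      init≈ element-atomic ≈refl (element'-cong (≈sym (con-app-injective objc eA)) (≈sym eL))
  ; true = λ θ e → ⊥-elim (headConst-≢⇒≉ (λ ()) e)
  ; and = λ θ k M P Q _ _ e → ⊥-elim (headConst-≢⇒≉ (λ ()) e)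
  ; imp = λ θ k M A P _ _ e → ⊥-elim (headConst-≢⇒≉ (λ ()) e)
  ; all = λ θ k M P _ _ e → ⊥-elim (headConst-≢⇒≉ (λ ()) e)
  }

seq-⋀⇒instances : {I : Tm Γ Tnt} {L : Tm Γ Tlst} {P : Tm Γ (Ti ⇒ Tprp)} →
                  Γ ⨾ seq' (s' I) L (⋀ P) ∷ G ⟶ fall Ti tt (lam (seq' (wk I) (wk L) (wk P · var here)))
seq-⋀⇒instances {Γ = Γ} {I = I} {L} {P} = seqL record
  { atom = λ θ x M a _ e → ⊥-elim (headConst-≢⇒≉ (λ ()) e)
  ; true = λ θ e → ⊥-elim (headConst-≢⇒≉ (λ ()) e)
  ; and = λ θ k M Q R _ _ e → ⊥-elim (headConst-≢⇒≉ (λ ()) e)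
  ; imp = λ θ k M A Q _ _ e → ⊥-elim (headConst-≢⇒≉ (λ ()) e)
  ; all = λ θ k M Q eI eL eP →
      allR-lam (allL-lam (var here) (conv-hyp (≡⇒≈ (sym (ext-there-[v0] _)))
        (init≈ seq-atomic ≈refl (seq'-cong (under-wk θ I (≈sym (con-app-injective sc eI))) (under-wk θ L (≈sym eL))
                                          (app≈ (under-wk θ P (≈sym (con-app-injective oallc eP))) ≈refl)))))
  }
  where
  under-wk : ∀ {Δ} (θ : Sub Γ Δ) (t : Tm Γ τ) {u : Tm Δ τ} → u ≈ subst θ t →
             wk {σ = Ti} u ≈ subst (exts θ) (wk t)
  under-wk θ t e = ≈trans (rename-≈ there e) (≡⇒≈ (sym (subst-exts-wk θ t)))

-- Monotonicity of seq in the context list, by induction on the height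

SeqMono : Tm Γ Tnt → Tm Γ Tlst → Tm Γ Tlst → Tm Γ Tprp → Form Γ
SeqMono K L L′ P = fimp (L ⊆' L′) (fimp (seq' K L P) (seq' K L′ P))

Mono₃ : Tm (Tlst ∷ Tlst ∷ Tprp ∷ Γ) Tnt → Form Γ
Mono₃ K = fall Tprp tt (lam (fall Tlst tt (lam (fall Tlst tt (lam (SeqMono K (var (there here)) (var here) (var (there (there here)))))))))

-- The induction invariant  ∀p ∀l ∀l′ (l ⊆ l′ ⊃ seq_K l p ⊃ seq_K l′ p).
Mono : Tm Γ Tnt → Form Γ
Mono K = Mono₃ (wk (wk (wk K)))

Mono-subst : (θ : Sub Γ Δ) (K : Tm Γ Tnt) → subst θ (Mono K) ≡ Mono (subst θ K)
Mono-subst θ K = cong Mono₃ (begin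
  subst (exts (exts (exts θ))) (wk (wk (wk K))) ≡⟨ subst-exts-wk (exts (exts θ)) (wk (wk K)) ⟩
  wk (subst (exts (exts θ)) (wk (wk K)))         ≡⟨ cong wk (subst-exts-wk (exts θ) (wk K)) ⟩
  wk (wk (subst (exts θ) (wk K)))                ≡⟨ cong (λ t → wk (wk t)) (subst-exts-wk θ K) ⟩
  wk (wk (wk (subst θ K)))                       ∎)
  where open ≡-Reasoning

Mono-wk : (K : Tm Γ Tnt) → wk {σ = σ} (Mono K) ≡ Mono (wk K)
Mono-wk K = cong Mono₃ (begin
  rename (ext (ext (ext there))) (wk (wk (wk K))) ≡⟨ rename-ext-wk (ext (ext there)) (wk (wk K)) ⟩
  wk (rename (ext (ext there)) (wk (wk K)))       ≡⟨ cong wk (rename-ext-wk (ext there) (wk K)) ⟩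
  wk (wk (rename (ext there) (wk K)))             ≡⟨ cong (λ t → wk (wk t)) (rename-ext-wk there K) ⟩
  wk (wk (wk (wk K)))                             ∎)
  where open ≡-Reasoning

Mono-elim : {K : Tm Γ Tnt} {L L′ : Tm Γ Tlst} {P : Tm Γ Tprp} →
            Γ ⨾ SeqMono K L L′ P ∷ G ⟶ C → Γ ⨾ Mono K ∷ G ⟶ C
Mono-elim {K = K} {L} {L′} {P} d = allL-lam P (allL-lam L (allL-lam L′ (conv-hyp (≡⇒≈ (sym instance≡)) d)))
  where
  σ₂ : Sub (Tlst ∷ Tprp ∷ _) _
  σ₂ = L ∷ₛ single P
  σ₁ : Sub (Tlst ∷ Tlst ∷ Tprp ∷ _) _
  σ₁ = L′ ∷ₛ σ₂
  step₂ : ∀ {τ} (x : _ ∋ τ) → subst (exts (single L)) (exts (exts (single P)) x) ≡ exts σ₂ x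
  step₂ here = refl
  step₂ (there here) = refl
  step₂ (there (there x)) = trans (subst-exts-wk (single L) (wk (single P x))) (cong wk (wk-[] (single P x) L))
  step₁ : ∀ {τ} (x : _ ∋ τ) → subst (single L′) (exts σ₂ x) ≡ σ₁ x
  step₁ here = refl
  step₁ (there x) = wk-[] (σ₂ x) L′
  K-instance : subst σ₁ (wk (wk (wk K))) ≡ K
  K-instance = trans (subst-rename (λ _ → refl) (wk (wk K)))
                 (trans (subst-rename (λ _ → refl) (wk K)) (trans (subst-rename (λ _ → refl) K) (subst-id (λ _ → refl) K)))
  matrix : Form (Tlst ∷ Tlst ∷ Tprp ∷ _)
  matrix = SeqMono (wk (wk (wk K))) (var (there here)) (var here) (var (there (there here)))
  instance≡ : subst (single L′) (subst (exts (single L)) (subst (exts (exts (single P))) matrix)) ≡ SeqMono K L L′ P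
  instance≡ = trans (cong (subst (single L′)) (subst-∘ step₂ matrix))
                (trans (subst-∘ step₁ matrix) (cong (λ K′ → SeqMono K′ L L′ P) K-instance))

Mono-apply : {K : Tm Γ Tnt} {L L′ : Tm Γ Tlst} {P : Tm Γ Tprp} →
             Γ ⨾ Mono K ∷ seq' K L P ∷ L ⊆' L′ ∷ G ⟶ seq' K L′ P
Mono-apply = Mono-elim (impL (exch-swap ⊆'-axiom) (impL (init seq-atomic) (init seq-atomic)))

seq-mono-atom : {K : Tm Γ Tnt} {x a : Tm Γ Tatm} {M L L′ : Tm Γ Tlst} {P : Tm Γ Tprp} →
                L ≈ x :: M → P ≈ ⟨ a ⟩ → Γ ⨾ element' a (x :: M) ∷ L ⊆' L′ ∷ G ⟶ seq' K L′ P
seq-mono-atom {a = a} {L = L} {L′} eL eP =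
  conv-hyp (element'-cong ≈refl eL)
    (conv-goal (seq'-cong ≈refl ≈refl (≈sym eP)) (cut {Δ = element' a L ∷ L ⊆' L′ ∷ []} ⊆'-apply element-seq))

seq-mono-zero : {L L′ : Tm Γ Tlst} {P : Tm Γ Tprp} → Γ ⨾ seq' z' L P ∷ L ⊆' L′ ∷ G ⟶ seq' z' L′ P
seq-mono-zero {L = L} {L′} = seqL record
  { atom = λ θ x M a eL eP → conv (≈refl ∷ ≡⇒≈ (sym (⊆'-subst L L′ θ)) ∷ ≈-refl*) ≈refl (seq-mono-atom eL eP)
  ; true = λ θ eP → conv-goal (seq'-cong ≈refl ≈refl (≈sym eP)) seq-ttR
  ; and = λ θ k M Q R e _ _ → ⊥-elim (headConst-≢⇒≉ (λ ()) e)
  ; imp = λ θ k M A Q e _ _ → ⊥-elim (headConst-≢⇒≉ (λ ()) e)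
  ; all = λ θ k M Q e _ _ → ⊥-elim (headConst-≢⇒≉ (λ ()) e)
  }

seq-mono-suc : {K : Tm Γ Tnt} {L L′ : Tm Γ Tlst} {P : Tm Γ Tprp} →
               Γ ⨾ seq' (s' K) L P ∷ L ⊆' L′ ∷ Mono K ∷ G ⟶ seq' (s' K) L′ P
seq-mono-suc {Γ = Γ} {K = K} {L} {L′} = seqL record
  { atom = λ θ x M a eL eP → restore θ (seq-mono-atom eL eP)
  ; true = λ θ eP → conv-goal (seq'-cong ≈refl ≈refl (≈sym eP)) seq-ttR
  ; and = λ θ k M Q R eK eL eP →
      restore θ (conv-goal (seq'-cong ≈refl ≈refl (≈sym eP))
        (seq-andR (andR (andL₁ (conv-hyp (seq'-cong (height eK) eL ≈refl) (exch-rot Mono-apply)))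
                        (andL₂ (conv-hyp (seq'-cong (height eK) eL ≈refl) (exch-rot Mono-apply))))))
  ; imp = λ θ k M A Q eK eL eP →
      restore θ (conv-goal (seq'-cong ≈refl ≈refl (≈sym eP))
        (seq-impR (exch-swap (cut {Δ = _ ∷ []} ⊆'-cons
          (exch-swap (conv-hyp (seq'-cong (height eK) (::-cong ≈refl eL) ≈refl) (exch-rot Mono-apply)))))))
  ; all = λ θ k M Q eK eL eP →
      restore θ (conv-goal (seq'-cong ≈refl ≈refl (≈sym eP))
        (seq-allR (allR-lam (conv (≈refl ∷ ≡⇒≈ (sym (⊆'-wk (subst θ L) (subst θ L′))) ∷ ≡⇒≈ (sym (Mono-wk (subst θ K))) ∷ ≈-refl*) ≈refl
          (allL-lam (var here) (conv-hyp (≈trans (seq'-cong (rename-≈ there (height eK)) (rename-≈ there eL) ≈refl)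
                                                 (≡⇒≈ (sym (ext-there-[v0] _))))
            (exch-rot Mono-apply)))))))
  }
  where
  height : ∀ {Δ} {θ : Sub Γ Δ} {k : Tm Δ Tnt} → subst θ (s' K) ≈ s' k → subst θ K ≈ k
  height = con-app-injective sc
  restore : ∀ {Δ} (θ : Sub Γ Δ) {H : Form Δ} {G′ : List (Form Δ)} {C : Form Δ} →
            Δ ⨾ H ∷ subst θ L ⊆' subst θ L′ ∷ Mono (subst θ K) ∷ G′ ⟶ C →
            Δ ⨾ H ∷ subst θ (L ⊆' L′) ∷ subst θ (Mono K) ∷ G′ ⟶ C
  restore θ = conv (≈refl ∷ ≡⇒≈ (sym (⊆'-subst L L′ θ)) ∷ ≡⇒≈ (sym (Mono-subst θ K)) ∷ ≈-refl*) ≈refl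

Mono-zero : Γ ⨾ G ⟶ Mono z'
Mono-zero = allR-lam (allR-lam (allR-lam (impR (impR seq-mono-zero))))

Mono-suc : Tnt ∷ Γ ⨾ Mono (var here) ∷ [] ⟶ Mono (s' (var here))
Mono-suc = allR-lam (allR-lam (allR-lam (impR (impR seq-mono-suc))))

seq-mono : {J : Tm Γ Tnt} {L L′ : Tm Γ Tlst} {P : Tm Γ Tprp} →
           Γ ⨾ nat' J ∷ seq' J L P ∷ L ⊆' L′ ∷ G ⟶ seq' J L′ P
seq-mono {J = J} = natInd (lam (Mono (var here)))
  (conv-goal (≈sym (β≈ _ z')) Mono-zero)
  (conv (≈sym (β≈ _ (var here)) ∷ ≈-refl*) (≈sym (β≈ _ (s' (var here)))) Mono-suc)
  (conv-hyp (≈sym (β≈ _ J)) Mono-apply)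

⊢-wk : (L : Tm Γ Tlst) (P : Tm Γ Tprp) → wk {σ = σ} (⊢ L ⟦ P ⟧) ≡ ⊢ wk L ⟦ wk P ⟧
⊢-wk L P = cong₂ (λ M Q → fex Tnt tt (lam (fand (nat' (var here)) (seq' (var here) M Q))))
                 (rename-ext-wk there L) (rename-ext-wk there P)

⊢-mono : {L L′ : Tm Γ Tlst} {P : Tm Γ Tprp} → Γ ⨾ ⊢ L ⟦ P ⟧ ∷ L ⊆' L′ ∷ G ⟶ ⊢ L′ ⟦ P ⟧
⊢-mono {L = L} {L′} {P} =
  exL-lam (conv (≈refl ∷ ≡⇒≈ (sym (⊆'-wk L L′)) ∷ ≈-refl*) (≡⇒≈ (sym (⊢-wk L′ P)))
    (exR-lam (var here) (conv-goal (≡⇒≈ (sym witness)) (andR (andL₁ (init nat-atomic))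
                                                             (contr (andL₂ (exch-swap (andL₁ seq-mono))))))))
  where
  witness : fand (nat' (var here)) (seq' (var here) (wk (wk L′)) (wk (wk P))) [ var here ]
            ≡ fand (nat' (var here)) (seq' (var here) (wk L′) (wk P))
  witness = cong₂ (λ M Q → fand (nat' (var here)) (seq' (var here) M Q)) (wk-[] (wk L′) (var here)) (wk-[] (wk P) (var here))

⊢-obj⇒cons-⊆' : {A : Tm Γ Tatm} {L : Tm Γ Tlst} → Γ ⨾ ⊢ L ⟦ ⟨ A ⟩ ⟧ ∷ [] ⟶ (A :: L) ⊆' L
⊢-obj⇒cons-⊆' {A = A} {L} =
  exL-lam (conv-goal (≡⇒≈ (sym (⊆'-wk (A :: L) L))) (andL₂ (cut {Δ = _ ∷ []} seq-obj⇒element element⇒cons-⊆')))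

⊢-cut : {A : Tm Γ Tatm} {L : Tm Γ Tlst} {P : Tm Γ Tprp} → Γ ⨾ ⊢ L ⟦ ⟨ A ⟩ ⟧ ∷ ⊢ (A :: L) ⟦ P ⟧ ∷ G ⟶ ⊢ L ⟦ P ⟧
⊢-cut = cut {Δ = _ ∷ []} ⊢-obj⇒cons-⊆' (exch-swap ⊢-mono)

theorem5p2 : Derivable Specialization × Derivable CutFormula × Derivable Structural
theorem5p2 =
  allR-lam (allR-lam (allR-lam (impR (impR seq-⋀⇒instances)))) ,
  allR-lam (allR-lam (allR-lam (impR (impR ⊢-cut)))) ,
  allR-lam (allR-lam (allR-lam (allR-lam (impR (impR (impR (exch-rot seq-mono)))))))
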